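{- Let $A=\{1,a_2,a_3,\ldots\}$ be a (finite or infinite) set of positive integers with $1<a_2<a_3<\cdots$ such that $a_k-a_l\geqslant a_3$ for every $k>l\geqslant 4$. Then $$p_A(w\mid\text{no } a_2\text{'s})\;p_A(z)\;\geqslant\; p_A(w+z\mid \text{no } a_2\text{'s})$$ for all positive integers $w\geqslant a_3+1$ and $z\geqslant 3a_2$.
   Context: For a set $A$ of positive integers, an $A$-partition of $n$ is a partition of $n$ all of whose parts belong to $A$, and $p_A(n)$ denotes the number of $A$-partitions of $n$. The quantity $p_A(n\mid\text{no } a_2\text{'s})$ denotes the number of $A$-partitions of $n$ in which $a_2$ does not occur as a part. -}

module Defs where

open import Data.Nat using (ℕ; zero; suc; _+_; _*_; _∸_; _≤ᵇ_; _≡ᵇ_)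
open import Data.Bool using (Bool; true; false; _∧_; not; if_then_else_)
open import Data.List using (List; []; _∷_; _++_; map; concatMap; filterᵇ; length; replicate; upTo)

boundedPartitions : ℕ → ℕ → List (List ℕ)
boundedPartitions zero zero = [] ∷ []
boundedPartitions zero (suc n) = []
boundedPartitions (suc m) n =
  concatMap (λ k → map (λ rest → replicate k (suc m) ++ rest)
                       (boundedPartitions m (n ∸ k * suc m)))
            (filterᵇ (λ k → k * suc m ≤ᵇ n) (upTo (suc n)))

partitions : ℕ → List (List ℕ)
partitions n = boundedPartitions n n

allParts : (ℕ → Bool) → List ℕ → Bool
allParts P [] = true
allParts P (x ∷ xs) = P x ∧ allParts P xs

pA : (ℕ → Bool) → ℕ → ℕ
pA A n = length (filterᵇ (allParts A) (partitions n))

pANo : (ℕ → Bool) → ℕ → ℕ → ℕ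
pANo A a n = length (filterᵇ (allParts (λ x → A x ∧ not (x ≡ᵇ a))) (partitions n))

{-# OPTIONS --safe #-}
-- Write A = S ∪ {1, a₂, a₃} with S = A ∩ (a₃, ∞).  Then p_A = e ⋆ ψ and p_A(· | no a₂'s) = e ⋆ φ,
-- where e = p_S, φ = p_{1,a₃}, ψ = p_{1,a₂,a₃} and ⋆ is convolution.  As φ(n) = 1 + φ(n − a₃) for
-- n ≥ a₃, F = e ⋆ φ satisfies F(n) = G(n) + F(n − a₃) with G(n) = Σ_{t ≤ n} e(t); so induction on w
-- in steps of a₃ reduces the claim to G(x + y) ≤ G(x) p_A(y) and to the range a₃ ≤ w < 2a₃.
-- Both follow by decomposing a partition into parts from S, either into its smallest parts of
-- total t ≤ x and a rest whose parts exceed x − t, or into its largest part and the rest.  Since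
-- distinct elements of S are at least a₃ apart, an interval of length ℓ contains at most ⌈ℓ / a₃⌉
-- of them, and the weights that arise are dominated termwise by ψ.
module Submission where

open import Defs
open import Data.Bool using (Bool; true; false; T; if_then_else_; _∧_; _∨_; not)
open import Data.Bool.Properties using (∨-zeroʳ; ∨-identityʳ; ∧-zeroʳ; ∧-identityʳ; not-¬)
open import Data.Empty using (⊥; ⊥-elim)
open import Data.List using (List; []; _∷_; _++_; map; concatMap; filterᵇ; length; replicate; applyUpTo)
open import Data.List.Properties using (filter-++; length-++)
open import Data.Nat
open import Data.Nat.DivMod using (_/_; m<n⇒m/n≡0; m/n≡1+[m∸n]/n; /-monoˡ-≤)
open import Data.Nat.Induction using (<-wellFounded)
open import Data.Nat.Properties
open import Data.Nat.Tactic.RingSolver using (solve-∀)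
open import Algebra.Properties.CommutativeSemigroup +-commutativeSemigroup using (interchange; x∙yz≈y∙xz; xy∙z≈xz∙y)
open import Data.Product using (_×_; _,_; proj₁; proj₂)
open import Data.Sum using (inj₁; inj₂)
open import Data.Unit using (tt)
open import Function using (_∘_)
open import Induction.WellFounded using (Acc; acc)
open import Relation.Binary using (tri<; tri≈; tri>)
open import Relation.Binary.PropositionalEquality
open import Relation.Nullary using (yes; no)

-- Finite sums and Iverson brackets

Σ< : (ℕ → ℕ) → ℕ → ℕ
Σ< f zero = 0
Σ< f (suc n) = Σ< f n + f n

infixr 8 [_]×_

[_]×_ : Bool → ℕ → ℕ
[ b ]× v = if b then v else 0

Σ<-cong : ∀ {f g} n → (∀ k → k < n → f k ≡ g k) → Σ< f n ≡ Σ< g n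
Σ<-cong zero h = refl
Σ<-cong (suc n) h = cong₂ _+_ (Σ<-cong n (λ k k<n → h k (m<n⇒m<1+n k<n))) (h n ≤-refl)

Σ<-mono : ∀ {f g} n → (∀ k → k < n → f k ≤ g k) → Σ< f n ≤ Σ< g n
Σ<-mono zero h = z≤n
Σ<-mono (suc n) h = +-mono-≤ (Σ<-mono n (λ k k<n → h k (m<n⇒m<1+n k<n))) (h n ≤-refl)

Σ<-≡0 : ∀ {f} n → (∀ k → k < n → f k ≡ 0) → Σ< f n ≡ 0
Σ<-≡0 n h = trans (Σ<-cong n h) (zeros n)
  where
  zeros : ∀ n → Σ< (λ _ → 0) n ≡ 0
  zeros zero = refl
  zeros (suc n) = trans (+-identityʳ _) (zeros n)

Σ<-+ : ∀ (f g : ℕ → ℕ) n → Σ< (λ k → f k + g k) n ≡ Σ< f n + Σ< g n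
Σ<-+ f g zero = refl
Σ<-+ f g (suc n) rewrite Σ<-+ f g n = interchange (Σ< f n) (Σ< g n) (f n) (g n)

Σ<-*ʳ : ∀ (f : ℕ → ℕ) c n → Σ< (λ k → f k * c) n ≡ Σ< f n * c
Σ<-*ʳ f c zero = refl
Σ<-*ʳ f c (suc n) rewrite Σ<-*ʳ f c n = sym (*-distribʳ-+ c (Σ< f n) (f n))

Σ<-unfoldˡ : ∀ (f : ℕ → ℕ) n → Σ< f (suc n) ≡ f 0 + Σ< (λ k → f (suc k)) n
Σ<-unfoldˡ f zero = +-comm 0 (f 0)
Σ<-unfoldˡ f (suc n) rewrite Σ<-unfoldˡ f n = +-assoc (f 0) _ _

Σ<-split : ∀ (f : ℕ → ℕ) m n → Σ< f (m + n) ≡ Σ< f m + Σ< (λ k → f (m + k)) n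
Σ<-split f m zero rewrite +-identityʳ m = sym (+-identityʳ _)
Σ<-split f m (suc n) rewrite +-suc m n | Σ<-split f m n = +-assoc (Σ< f m) _ _

Σ<-truncate : ∀ (f : ℕ → ℕ) {m n} → m ≤ n → (∀ k → m ≤ k → k < n → f k ≡ 0) → Σ< f n ≡ Σ< f m
Σ<-truncate f {m} {n} m≤n h = begin
  Σ< f n                                      ≡⟨ cong (Σ< f) (sym (m+[n∸m]≡n m≤n)) ⟩
  Σ< f (m + (n ∸ m))                          ≡⟨ Σ<-split f m (n ∸ m) ⟩
  Σ< f m + Σ< (λ k → f (m + k)) (n ∸ m)       ≡⟨ cong (Σ< f m +_) (Σ<-≡0 (n ∸ m) tail≡0) ⟩
  Σ< f m + 0                                  ≡⟨ +-identityʳ _ ⟩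
  Σ< f m                                      ∎
  where
  open ≡-Reasoning
  tail≡0 : ∀ k → k < n ∸ m → f (m + k) ≡ 0
  tail≡0 k k< = h (m + k) (m≤m+n m k) (subst (m + k <_) (m+[n∸m]≡n m≤n) (+-monoʳ-< m k<))

Σ<-truncate-* : ∀ (f h : ℕ → ℕ) {m n} → m ≤ n → (∀ k → m ≤ k → k < n → h k ≡ 0) →
  Σ< (λ k → f k * h k) n ≡ Σ< (λ k → f k * h k) m
Σ<-truncate-* f h m≤n h≡0 = Σ<-truncate _ m≤n (λ k lo hi → trans (cong (f k *_) (h≡0 k lo hi)) (*-zeroʳ (f k)))

term≤Σ< : ∀ (f : ℕ → ℕ) {n} j → j < n → f j ≤ Σ< f n
term≤Σ< f {suc n} j j<1+n with m≤n⇒m<n∨m≡n (≤-pred j<1+n)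
... | inj₁ j<n = ≤-trans (term≤Σ< f j j<n) (m≤m+n _ _)
... | inj₂ refl = m≤n+m _ _

≤ᵇ-true : ∀ {m n} → m ≤ n → (m ≤ᵇ n) ≡ true
≤ᵇ-true {m} {n} m≤n with m ≤ᵇ n | ≤⇒≤ᵇ m≤n
... | true | _ = refl

≤ᵇ-false : ∀ {m n} → n < m → (m ≤ᵇ n) ≡ false
≤ᵇ-false {m} {n} n<m with m ≤ᵇ n | ≤ᵇ⇒≤ m n
... | false | _ = refl
... | true | m≤n = ⊥-elim (<⇒≱ n<m (m≤n tt))

≤ᵇ-true⁻ : ∀ {m n} → (m ≤ᵇ n) ≡ true → m ≤ n
≤ᵇ-true⁻ {m} {n} eq = ≤ᵇ⇒≤ m n (subst T (sym eq) tt)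

<ᵇ-true⁻ : ∀ {m n} → (m <ᵇ n) ≡ true → m < n
<ᵇ-true⁻ {m} {n} eq = <ᵇ⇒< m n (subst T (sym eq) tt)

≡ᵇ-refl : ∀ x → (x ≡ᵇ x) ≡ true
≡ᵇ-refl zero = refl
≡ᵇ-refl (suc x) = ≡ᵇ-refl x

≡ᵇ-false : ∀ {x y} → x ≢ y → (x ≡ᵇ y) ≡ false
≡ᵇ-false {x} {y} x≢y with x ≡ᵇ y in eq
... | false = refl
... | true = ⊥-elim (x≢y (≡ᵇ⇒≡ x y (subst T (sym eq) tt)))

∧-true : ∀ {x y} → (x ∧ y) ≡ true → x ≡ true × y ≡ true
∧-true {true} y≡true = refl , y≡true

[]×-0 : ∀ b → [ b ]× 0 ≡ 0
[]×-0 true = refl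
[]×-0 false = refl

[≤ᵇ]×-yes : ∀ {m n} v → m ≤ n → [ m ≤ᵇ n ]× v ≡ v
[≤ᵇ]×-yes v m≤n rewrite ≤ᵇ-true m≤n = refl

[≤ᵇ]×-no : ∀ {m n} v → n < m → [ m ≤ᵇ n ]× v ≡ 0
[≤ᵇ]×-no v n<m rewrite ≤ᵇ-false n<m = refl

[]×-≤ : ∀ b v → [ b ]× v ≤ v
[]×-≤ true v = ≤-refl
[]×-≤ false v = z≤n

[]×-mono : ∀ b {u v} → u ≤ v → [ b ]× u ≤ [ b ]× v
[]×-mono true u≤v = u≤v
[]×-mono false u≤v = z≤n

[]×-*ˡ : ∀ b u v → ([ b ]× u) * v ≡ [ b ]× (u * v)
[]×-*ˡ true u v = refl
[]×-*ˡ false u v = refl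

[]×-*ʳ : ∀ b u v → u * [ b ]× v ≡ [ b ]× (u * v)
[]×-*ʳ true u v = refl
[]×-*ʳ false u v = *-zeroʳ u

[]×-+ : ∀ b u v → [ b ]× (u + v) ≡ [ b ]× u + [ b ]× v
[]×-+ true u v = refl
[]×-+ false u v = refl

[]×-comm : ∀ b c v → [ b ]× [ c ]× v ≡ [ c ]× [ b ]× v
[]×-comm true c v = refl
[]×-comm false true v = refl
[]×-comm false false v = refl

Σ<-[]× : ∀ b (f : ℕ → ℕ) n → Σ< (λ k → [ b ]× f k) n ≡ [ b ]× Σ< f n
Σ<-[]× true f n = refl
Σ<-[]× false f n = Σ<-≡0 n (λ _ _ → refl)

[≤ᵇ]×-∸ : ∀ a b T v → [ a ≤ᵇ T ]× [ b ≤ᵇ T ∸ a ]× v ≡ [ a + b ≤ᵇ T ]× v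
[≤ᵇ]×-∸ a b T v with a + b ≤? T | a ≤? T
... | yes a+b≤T | _ = begin
  [ a ≤ᵇ T ]× [ b ≤ᵇ T ∸ a ]× v  ≡⟨ [≤ᵇ]×-yes _ (≤-trans (m≤m+n a b) a+b≤T) ⟩
  [ b ≤ᵇ T ∸ a ]× v              ≡⟨ [≤ᵇ]×-yes v (subst (_≤ T ∸ a) (m+n∸m≡n a b) (∸-monoˡ-≤ a a+b≤T)) ⟩
  v                              ≡⟨ [≤ᵇ]×-yes v a+b≤T ⟨
  [ a + b ≤ᵇ T ]× v              ∎
  where open ≡-Reasoning
... | no a+b≰T | no a≰T = trans ([≤ᵇ]×-no _ (≰⇒> a≰T)) (sym ([≤ᵇ]×-no v (≰⇒> a+b≰T)))
... | no a+b≰T | yes a≤T = begin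
  [ a ≤ᵇ T ]× [ b ≤ᵇ T ∸ a ]× v  ≡⟨ cong ([ a ≤ᵇ T ]×_) ([≤ᵇ]×-no v T∸a<b) ⟩
  [ a ≤ᵇ T ]× 0                  ≡⟨ []×-0 _ ⟩
  0                              ≡⟨ [≤ᵇ]×-no v (≰⇒> a+b≰T) ⟨
  [ a + b ≤ᵇ T ]× v              ∎
  where
  open ≡-Reasoning
  T∸a<b : T ∸ a < b
  T∸a<b = +-cancelˡ-< a (T ∸ a) b (subst (_< a + b) (sym (m+[n∸m]≡n a≤T)) (≰⇒> a+b≰T))

Σ<-shiftˡ : ∀ (h : ℕ → ℕ) c n →
  Σ< (λ t → [ c ≤ᵇ t ]× h t) (suc n) ≡ [ c ≤ᵇ n ]× Σ< (λ k → h (c + k)) (suc (n ∸ c))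
Σ<-shiftˡ h c n with c ≤? n
... | yes c≤n = begin
  Σ< g (suc n)                                      ≡⟨ cong (Σ< g) (trans (+-suc c (n ∸ c)) (cong suc (m+[n∸m]≡n c≤n))) ⟨
  Σ< g (c + suc (n ∸ c))                            ≡⟨ Σ<-split g c (suc (n ∸ c)) ⟩
  Σ< g c + Σ< (λ k → g (c + k)) (suc (n ∸ c))       ≡⟨ cong₂ _+_ (Σ<-≡0 c (λ k k<c → [≤ᵇ]×-no (h k) k<c))
                                                                 (Σ<-cong (suc (n ∸ c)) (λ k _ → [≤ᵇ]×-yes (h (c + k)) (m≤m+n c k))) ⟩
  Σ< (λ k → h (c + k)) (suc (n ∸ c))                ≡⟨ [≤ᵇ]×-yes _ c≤n ⟨
  [ c ≤ᵇ n ]× Σ< (λ k → h (c + k)) (suc (n ∸ c))   ∎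
  where
  open ≡-Reasoning
  g = λ t → [ c ≤ᵇ t ]× h t
... | no c≰n = trans (Σ<-≡0 (suc n) (λ k k<1+n → [≤ᵇ]×-no (h k) (<-≤-trans k<1+n (≰⇒> c≰n))))
                     (sym ([≤ᵇ]×-no _ (≰⇒> c≰n)))

Σ<-shiftʳ : ∀ (h : ℕ → ℕ) c n →
  Σ< (λ t → [ c ≤ᵇ n ∸ t ]× h t) (suc n) ≡ [ c ≤ᵇ n ]× Σ< h (suc (n ∸ c))
Σ<-shiftʳ h c n with c ≤? n
... | yes c≤n = begin
  Σ< g (suc n)                ≡⟨ Σ<-truncate g (s≤s (m∸n≤m n c)) (λ k lo hi → [≤ᵇ]×-no _ (too-far k lo hi)) ⟩
  Σ< g (suc (n ∸ c))          ≡⟨ Σ<-cong (suc (n ∸ c)) (λ k k< → [≤ᵇ]×-yes _ (in-range k k<)) ⟩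
  Σ< h (suc (n ∸ c))          ≡⟨ [≤ᵇ]×-yes _ c≤n ⟨
  [ c ≤ᵇ n ]× Σ< h (suc (n ∸ c)) ∎
  where
  open ≡-Reasoning
  g = λ t → [ c ≤ᵇ n ∸ t ]× h t
  too-far : ∀ k → suc (n ∸ c) ≤ k → k < suc n → n ∸ k < c
  too-far k lo hi = subst (n ∸ k <_) (m∸[m∸n]≡n c≤n) (∸-monoʳ-< lo (≤-pred hi))
  in-range : ∀ k → k < suc (n ∸ c) → c ≤ n ∸ k
  in-range k k< = subst (_≤ n ∸ k) (m∸[m∸n]≡n c≤n) (∸-monoʳ-≤ n (≤-pred k<))
... | no c≰n = trans (Σ<-≡0 (suc n) (λ k _ → [≤ᵇ]×-no _ (≤-<-trans (m∸n≤m n k) (≰⇒> c≰n))))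
                     (sym ([≤ᵇ]×-no _ (≰⇒> c≰n)))

[≤ᵇ]×-cong : ∀ {m n u v} → (m ≤ n → u ≡ v) → [ m ≤ᵇ n ]× u ≡ [ m ≤ᵇ n ]× v
[≤ᵇ]×-cong {m} {n} {u} {v} eq with m ≤? n
... | yes m≤n = trans ([≤ᵇ]×-yes u m≤n) (trans (eq m≤n) (sym ([≤ᵇ]×-yes v m≤n)))
... | no m≰n = trans ([≤ᵇ]×-no u (≰⇒> m≰n)) (sym ([≤ᵇ]×-no v (≰⇒> m≰n)))

[≤ᵇ]×-monoʳ : ∀ {m n u v} → (m ≤ n → u ≤ v) → [ m ≤ᵇ n ]× u ≤ [ m ≤ᵇ n ]× v
[≤ᵇ]×-monoʳ {m} {n} {u} {v} le with m ≤? n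
... | yes m≤n = subst₂ _≤_ (sym ([≤ᵇ]×-yes u m≤n)) (sym ([≤ᵇ]×-yes v m≤n)) (le m≤n)
... | no m≰n = ≤-reflexive (trans ([≤ᵇ]×-no u (≰⇒> m≰n)) (sym ([≤ᵇ]×-no v (≰⇒> m≰n))))

∸-comm : ∀ m n o → m ∸ n ∸ o ≡ m ∸ o ∸ n
∸-comm m n o = trans (∸-+-assoc m n o) (trans (cong (m ∸_) (+-comm n o)) (sym (∸-+-assoc m o n)))

*-[]×[]×1 : ∀ a b u → u * [ a ]× [ b ]× 1 ≡ [ a ]× [ b ]× u
*-[]×[]×1 true true u = *-identityʳ u
*-[]×[]×1 true false u = *-zeroʳ u
*-[]×[]×1 false b u = *-zeroʳ u

[]×-∧ : ∀ a b v → [ a ∧ b ]× v ≡ [ a ]× [ b ]× v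
[]×-∧ true b v = refl
[]×-∧ false b v = refl

+-∸-≤ : ∀ s y t → s + y ∸ t ≤ s + (y ∸ t)
+-∸-≤ s y t = m≤n+o⇒m∸n≤o (s + y) t (begin
  s + y              ≤⟨ +-monoʳ-≤ s (m≤n+m∸n y t) ⟩
  s + (t + (y ∸ t))  ≡⟨ x∙yz≈y∙xz s t (y ∸ t) ⟩
  t + (s + (y ∸ t))  ∎)
  where open ≤-Reasoning

Pred : Set
Pred = ℕ → Bool

_⊆_ : Pred → Pred → Set
P ⊆ Q = ∀ x → P x ≡ true → Q x ≡ true

card : Pred → ℕ → ℕ
card Z N = Σ< (λ D → [ Z D ]× 1) N

card-split : ∀ Z (p : Pred) N → card Z N ≡ card (λ D → Z D ∧ p D) N + card (λ D → Z D ∧ not (p D)) N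
card-split Z p N = trans (Σ<-cong N (λ D _ → split (Z D) (p D))) (Σ<-+ _ _ N)
  where
  split : ∀ z q → [ z ]× 1 ≡ [ z ∧ q ]× 1 + [ z ∧ not q ]× 1
  split true true = refl
  split true false = refl
  split false q = refl

card-≤1 : ∀ Z N → (∀ {D D′} → Z D ≡ true → Z D′ ≡ true → D < D′ → ⊥) → card Z N ≤ 1
card-≤1 Z zero _ = z≤n
card-≤1 Z (suc N) unique with Z N in Z[N]
... | false = subst (_≤ 1) (sym (+-identityʳ _)) (card-≤1 Z N unique)
... | true = subst (_≤ 1) (sym (cong (_+ 1) (Σ<-≡0 N (λ D D<N → none-before D D<N)))) ≤-refl
  where
  none-before : ∀ D → D < N → [ Z D ]× 1 ≡ 0
  none-before D D<N with Z D in Z[D]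
  ... | false = refl
  ... | true = ⊥-elim (unique Z[D] Z[N] D<N)

card-≡0 : ∀ Z N → (∀ D → Z D ≡ false) → card Z N ≡ 0
card-≡0 Z N empty = Σ<-≡0 N (λ D _ → cong ([_]× 1) (empty D))

-- Counting partitions with bounded parts

module _ {A : Set} where

  length-filterᵇ-++ : ∀ (p : A → Bool) xs ys →
    length (filterᵇ p (xs ++ ys)) ≡ length (filterᵇ p xs) + length (filterᵇ p ys)
  length-filterᵇ-++ p xs ys = trans (cong length (filter-++ _ xs ys)) (length-++ (filterᵇ p xs))

  length-filterᵇ-cong : ∀ {p q : A → Bool} → (∀ x → p x ≡ q x) → ∀ xs →
    length (filterᵇ p xs) ≡ length (filterᵇ q xs)
  length-filterᵇ-cong p≗q [] = refl
  length-filterᵇ-cong {q = q} p≗q (x ∷ xs) rewrite p≗q x with q x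
  ... | true = cong suc (length-filterᵇ-cong p≗q xs)
  ... | false = length-filterᵇ-cong p≗q xs

  length-filterᵇ-∧ˡ : ∀ b (q : A → Bool) xs → length (filterᵇ (λ x → b ∧ q x) xs) ≡ [ b ]× length (filterᵇ q xs)
  length-filterᵇ-∧ˡ true q xs = refl
  length-filterᵇ-∧ˡ false q [] = refl
  length-filterᵇ-∧ˡ false q (x ∷ xs) = length-filterᵇ-∧ˡ false q xs

  length-filterᵇ-map : ∀ {B : Set} (p : B → Bool) (f : A → B) xs →
    length (filterᵇ p (map f xs)) ≡ length (filterᵇ (λ x → p (f x)) xs)
  length-filterᵇ-map p f [] = refl
  length-filterᵇ-map p f (x ∷ xs) with p (f x)
  ... | true = cong suc (length-filterᵇ-map p f xs)
  ... | false = length-filterᵇ-map p f xs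

length-filterᵇ-concatMap-applyUpTo : ∀ {B : Set} (p : B → Bool) (g : ℕ → List B) (q : ℕ → Bool) f n →
  length (filterᵇ p (concatMap g (filterᵇ q (applyUpTo f n))))
    ≡ Σ< (λ k → [ q (f k) ]× length (filterᵇ p (g (f k)))) n
length-filterᵇ-concatMap-applyUpTo p g q f zero = refl
length-filterᵇ-concatMap-applyUpTo p g q f (suc n) =
  trans head+tail (sym (Σ<-unfoldˡ (λ k → [ q (f k) ]× length (filterᵇ p (g (f k)))) n))
  where
  IH = length-filterᵇ-concatMap-applyUpTo p g q (λ k → f (suc k)) n
  head+tail : length (filterᵇ p (concatMap g (filterᵇ q (applyUpTo f (suc n)))))
    ≡ [ q (f 0) ]× length (filterᵇ p (g (f 0))) + Σ< (λ k → [ q (f (suc k)) ]× length (filterᵇ p (g (f (suc k))))) n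
  head+tail with q (f 0)
  ... | true = trans (length-filterᵇ-++ p (g (f 0)) _) (cong (length (filterᵇ p (g (f 0))) +_) IH)
  ... | false = IH

allParts-replicate-++ : ∀ P k c r → allParts P (replicate k c ++ r) ≡ ((k ≡ᵇ 0) ∨ P c) ∧ allParts P r
allParts-replicate-++ P zero c r = refl
allParts-replicate-++ P (suc k) c r rewrite allParts-replicate-++ P k c r with P c
... | true rewrite ∨-zeroʳ (k ≡ᵇ 0) = refl
... | false = refl

count : Pred → ℕ → ℕ → ℕ
count P m n = length (filterᵇ (allParts P) (boundedPartitions m n))

count-unfold : ∀ P m n → count P (suc m) n ≡
  Σ< (λ k → [ k * suc m ≤ᵇ n ]× [ (k ≡ᵇ 0) ∨ P (suc m) ]× count P m (n ∸ k * suc m)) (suc n)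
count-unfold P m n =
  trans (length-filterᵇ-concatMap-applyUpTo (allParts P) blocks (λ k → k * suc m ≤ᵇ n) (λ k → k) (suc n))
        (Σ<-cong (suc n) (λ k _ → cong ([ k * suc m ≤ᵇ n ]×_) (count-blocks k)))
  where
  blocks : ℕ → List (List ℕ)
  blocks k = map (λ rest → replicate k (suc m) ++ rest) (boundedPartitions m (n ∸ k * suc m))
  count-blocks : ∀ k → length (filterᵇ (allParts P) (blocks k)) ≡ [ (k ≡ᵇ 0) ∨ P (suc m) ]× count P m (n ∸ k * suc m)
  count-blocks k = begin
    length (filterᵇ (allParts P) (blocks k))
      ≡⟨ length-filterᵇ-map (allParts P) _ (boundedPartitions m (n ∸ k * suc m)) ⟩
    length (filterᵇ (λ r → allParts P (replicate k (suc m) ++ r)) (boundedPartitions m (n ∸ k * suc m)))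
      ≡⟨ length-filterᵇ-cong (allParts-replicate-++ P k (suc m)) (boundedPartitions m (n ∸ k * suc m)) ⟩
    length (filterᵇ (λ r → ((k ≡ᵇ 0) ∨ P (suc m)) ∧ allParts P r) (boundedPartitions m (n ∸ k * suc m)))
      ≡⟨ length-filterᵇ-∧ˡ ((k ≡ᵇ 0) ∨ P (suc m)) (allParts P) (boundedPartitions m (n ∸ k * suc m)) ⟩
    [ (k ≡ᵇ 0) ∨ P (suc m) ]× count P m (n ∸ k * suc m) ∎
    where open ≡-Reasoning

-- The summands k ≥ 1 of count-unfold, reindexed, are those of count P (suc m) (n ∸ suc m).
count-suc : ∀ P m n →
  count P (suc m) n ≡ count P m n + [ P (suc m) ]× [ suc m ≤ᵇ n ]× count P (suc m) (n ∸ suc m)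
count-suc P m n = trans (count-unfold P m n) (trans (Σ<-unfoldˡ term n) (cong (count P m n +_) higher))
  where
  c = suc m
  term : ℕ → ℕ
  term k = [ k * c ≤ᵇ n ]× [ (k ≡ᵇ 0) ∨ P c ]× count P m (n ∸ k * c)
  term′ : ℕ → ℕ
  term′ k = [ k * c ≤ᵇ n ∸ c ]× count P m ((n ∸ c) ∸ k * c)
  shifted : ∀ k → [ c + k * c ≤ᵇ n ]× count P m (n ∸ (c + k * c)) ≡ [ c ≤ᵇ n ]× term′ k
  shifted k = trans (cong ([ c + k * c ≤ᵇ n ]×_ ∘ count P m) (sym (∸-+-assoc n c (k * c))))
                    (sym ([≤ᵇ]×-∸ c (k * c) n _))
  rest : P c ≡ true → c ≤ n → Σ< term′ n ≡ count P c (n ∸ c)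
  rest Pc c≤n = begin
    Σ< term′ n
      ≡⟨ Σ<-truncate term′ (∸-monoʳ-< {n} {c} {0} z<s c≤n) (λ k lo _ → [≤ᵇ]×-no _ (≤-trans lo (m≤m*n k c))) ⟩
    Σ< term′ (suc (n ∸ c))
      ≡⟨ Σ<-cong (suc (n ∸ c)) (λ k _ → cong (λ b → [ k * c ≤ᵇ n ∸ c ]× [ b ]× count P m ((n ∸ c) ∸ k * c)) (sym (P-or k))) ⟩
    _
      ≡⟨ count-unfold P m (n ∸ c) ⟨
    count P c (n ∸ c) ∎
    where
    open ≡-Reasoning
    P-or : ∀ k → ((k ≡ᵇ 0) ∨ P c) ≡ true
    P-or k = trans (cong ((k ≡ᵇ 0) ∨_) Pc) (∨-zeroʳ (k ≡ᵇ 0))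
  higher : Σ< (λ k → term (suc k)) n ≡ [ P c ]× [ c ≤ᵇ n ]× count P c (n ∸ c)
  higher with P c in Pc
  ... | false = Σ<-≡0 n (λ k _ → []×-0 _)
  ... | true = trans (Σ<-cong n (λ k _ → shifted k))
                     (trans (Σ<-[]× (c ≤ᵇ n) term′ n) ([≤ᵇ]×-cong (rest Pc)))

count-suc-∈ : ∀ P m → P (suc m) ≡ true → ∀ n →
  count P (suc m) n ≡ count P m n + [ suc m ≤ᵇ n ]× count P (suc m) (n ∸ suc m)
count-suc-∈ P m P[1+m] n =
  trans (count-suc P m n) (cong (λ b → count P m n + [ b ]× [ suc m ≤ᵇ n ]× count P (suc m) (n ∸ suc m)) P[1+m])

count-cong : ∀ {P Q : Pred} → (∀ x → P x ≡ Q x) → ∀ m n → count P m n ≡ count Q m n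
count-cong P≗Q m n = length-filterᵇ-cong (allParts-cong P≗Q) (boundedPartitions m n)
  where
  allParts-cong : ∀ {P Q : Pred} → (∀ x → P x ≡ Q x) → ∀ xs → allParts P xs ≡ allParts Q xs
  allParts-cong P≗Q [] = refl
  allParts-cong P≗Q (x ∷ xs) = cong₂ _∧_ (P≗Q x) (allParts-cong P≗Q xs)

count-empty : ∀ P m → count P m 0 ≡ 1
count-empty P zero = refl
count-empty P (suc m) = begin
  count P (suc m) 0                                              ≡⟨ count-suc P m 0 ⟩
  count P m 0 + [ P (suc m) ]× [ suc m ≤ᵇ 0 ]× count P (suc m) 0 ≡⟨ cong (count P m 0 +_) ([]×-0 (P (suc m))) ⟩
  count P m 0 + 0                                                ≡⟨ +-identityʳ _ ⟩
  count P m 0                                                    ≡⟨ count-empty P m ⟩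
  1                                                              ∎
  where open ≡-Reasoning

count-skip : ∀ P m n → P (suc m) ≡ false → count P (suc m) n ≡ count P m n
count-skip P m n P[1+m]≡false = begin
  count P (suc m) n                   ≡⟨ count-suc P m n ⟩
  count P m n + [ P (suc m) ]× later  ≡⟨ cong (λ b → count P m n + [ b ]× later) P[1+m]≡false ⟩
  count P m n + 0                     ≡⟨ +-identityʳ _ ⟩
  count P m n                         ∎
  where
  open ≡-Reasoning
  later = [ suc m ≤ᵇ n ]× count P (suc m) (n ∸ suc m)

count-beyond : ∀ P m n → n < suc m → count P (suc m) n ≡ count P m n
count-beyond P m n n<1+m = begin
  count P (suc m) n                                          ≡⟨ count-suc P m n ⟩
  count P m n + [ P (suc m) ]× [ suc m ≤ᵇ n ]× later         ≡⟨ cong (λ v → count P m n + [ P (suc m) ]× v) ([≤ᵇ]×-no later n<1+m) ⟩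
  count P m n + [ P (suc m) ]× 0                             ≡⟨ cong (count P m n +_) ([]×-0 (P (suc m))) ⟩
  count P m n + 0                                            ≡⟨ +-identityʳ _ ⟩
  count P m n                                                ∎
  where
  open ≡-Reasoning
  later = count P (suc m) (n ∸ suc m)

count-skip-range : ∀ P {m m′} n → m ≤ m′ → (∀ x → m < x → x ≤ m′ → P x ≡ false) → count P m′ n ≡ count P m n
count-skip-range P {m} {zero} n z≤n _ = refl
count-skip-range P {m} {suc m′} n m≤1+m′ skip with m ≟ suc m′
... | yes refl = refl
... | no m≢1+m′ = trans (count-skip P m′ n (skip (suc m′) m<1+m′ ≤-refl))
                        (count-skip-range P n (≤-pred m<1+m′) (λ x m<x x≤m′ → skip x m<x (m≤n⇒m≤1+n x≤m′)))
  where
  m<1+m′ : m < suc m′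
  m<1+m′ = ≤∧≢⇒< m≤1+m′ m≢1+m′

count-stable : ∀ P {m} n → n ≤ m → count P m n ≡ count P n n
count-stable P {zero} n z≤n = refl
count-stable P {suc m} n n≤1+m with n ≟ suc m
... | yes refl = refl
... | no n≢1+m = trans (count-beyond P m n (≤∧≢⇒< n≤1+m n≢1+m)) (count-stable P n (≤-pred (≤∧≢⇒< n≤1+m n≢1+m)))

count-≤-suc : ∀ P m n → count P m n ≤ count P (suc m) n
count-≤-suc P m n = subst (count P m n ≤_) (sym (count-suc P m n)) (m≤m+n _ _)

count-ones : ∀ P → P 1 ≡ true → ∀ n → count P 1 n ≡ 1
count-ones P P1 zero = refl
count-ones P P1 (suc n) rewrite count-suc P 0 (suc n) | P1 = count-ones P P1 n

count-mono : ∀ {P Q} → P ⊆ Q → ∀ m n → count P m n ≤ count Q m n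
count-mono {P} {Q} P⊆Q m n = go m n (<-wellFounded n)
  where
  go : ∀ m n → Acc _<_ n → count P m n ≤ count Q m n
  go zero zero _ = ≤-refl
  go zero (suc n) _ = ≤-refl
  go (suc m) n (acc rs) rewrite count-suc P m n | count-suc Q m n =
    +-mono-≤ (go m n (acc rs)) (larger (P (suc m)) refl)
    where
    larger : ∀ b → P (suc m) ≡ b → [ b ]× [ suc m ≤ᵇ n ]× count P (suc m) (n ∸ suc m)
                                   ≤ [ Q (suc m) ]× [ suc m ≤ᵇ n ]× count Q (suc m) (n ∸ suc m)
    larger false _ = z≤n
    larger true P[1+m] rewrite P⊆Q (suc m) P[1+m] =
      [≤ᵇ]×-monoʳ (λ 1+m≤n → go (suc m) (n ∸ suc m) (rs (∸-monoʳ-< z<s 1+m≤n)))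

count-largest : ∀ P {c M} → 0 < c → c ≤ M → P c ≡ true → (∀ x → c < x → x ≤ M → P x ≡ false) →
  ∀ n → count P M n ≡ count P (c ∸ 1) n + [ c ≤ᵇ n ]× count P M (n ∸ c)
count-largest P {suc c′} {M} _ c≤M P[c] none n = begin
  count P M n                                                  ≡⟨ count-skip-range P n c≤M none ⟩
  count P (suc c′) n                                           ≡⟨ count-suc-∈ P c′ P[c] n ⟩
  count P c′ n + [ suc c′ ≤ᵇ n ]× count P (suc c′) (n ∸ suc c′)
    ≡⟨ cong (λ v → count P c′ n + [ suc c′ ≤ᵇ n ]× v) (count-skip-range P (n ∸ suc c′) c≤M none) ⟨
  count P c′ n + [ suc c′ ≤ᵇ n ]× count P M (n ∸ suc c′)       ∎
  where open ≡-Reasoning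

-- Convolution

conv : (ℕ → ℕ) → (ℕ → ℕ) → ℕ → ℕ
conv f g n = Σ< (λ t → f t * g (n ∸ t)) (suc n)

Σ<-reverse : ∀ (f : ℕ → ℕ) n → Σ< f (suc n) ≡ Σ< (λ t → f (n ∸ t)) (suc n)
Σ<-reverse f zero = refl
Σ<-reverse f (suc n) = begin
  Σ< f (suc n) + f (suc n)                          ≡⟨ cong (_+ f (suc n)) (Σ<-reverse f n) ⟩
  Σ< (λ t → f (n ∸ t)) (suc n) + f (suc n)          ≡⟨ +-comm _ (f (suc n)) ⟩
  f (suc n) + Σ< (λ t → f (n ∸ t)) (suc n)          ≡⟨ Σ<-unfoldˡ (λ t → f (suc n ∸ t)) (suc n) ⟨
  Σ< (λ t → f (suc n ∸ t)) (suc (suc n))            ∎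
  where open ≡-Reasoning

conv-comm : ∀ f g n → conv f g n ≡ conv g f n
conv-comm f g n = trans (Σ<-reverse _ n) (Σ<-cong (suc n) swap)
  where
  swap : ∀ t → t < suc n → f (n ∸ t) * g (n ∸ (n ∸ t)) ≡ g t * f (n ∸ t)
  swap t t<1+n = trans (cong (λ u → f (n ∸ t) * g u) (m∸[m∸n]≡n (≤-pred t<1+n))) (*-comm (f (n ∸ t)) (g t))

conv-congʳ : ∀ f {g g′} → (∀ n → g n ≡ g′ n) → ∀ n → conv f g n ≡ conv f g′ n
conv-congʳ f g≗g′ n = Σ<-cong (suc n) (λ t _ → cong (f t *_) (g≗g′ (n ∸ t)))

conv-stepˡ : ∀ c f f′ g → (∀ n → f′ n ≡ f n + [ c ≤ᵇ n ]× f′ (n ∸ c)) →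
  ∀ n → conv f′ g n ≡ conv f g n + [ c ≤ᵇ n ]× conv f′ g (n ∸ c)
conv-stepˡ c f f′ g rec n = begin
  conv f′ g n
    ≡⟨ Σ<-cong (suc n) (λ t _ → trans (cong (_* g (n ∸ t)) (rec t)) (*-distribʳ-+ (g (n ∸ t)) (f t) _)) ⟩
  Σ< (λ t → f t * g (n ∸ t) + ([ c ≤ᵇ t ]× f′ (t ∸ c)) * g (n ∸ t)) (suc n)
    ≡⟨ Σ<-+ _ _ (suc n) ⟩
  conv f g n + Σ< (λ t → ([ c ≤ᵇ t ]× f′ (t ∸ c)) * g (n ∸ t)) (suc n)
    ≡⟨ cong (conv f g n +_) (Σ<-cong (suc n) (λ t _ → []×-*ˡ (c ≤ᵇ t) _ _)) ⟩
  conv f g n + Σ< (λ t → [ c ≤ᵇ t ]× (f′ (t ∸ c) * g (n ∸ t))) (suc n)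
    ≡⟨ cong (conv f g n +_) (Σ<-shiftˡ (λ t → f′ (t ∸ c) * g (n ∸ t)) c n) ⟩
  conv f g n + [ c ≤ᵇ n ]× Σ< (λ k → f′ (c + k ∸ c) * g (n ∸ (c + k))) (suc (n ∸ c))
    ≡⟨ cong (λ v → conv f g n + [ c ≤ᵇ n ]× v) (Σ<-cong (suc (n ∸ c)) reindex) ⟩
  conv f g n + [ c ≤ᵇ n ]× conv f′ g (n ∸ c) ∎
  where
  open ≡-Reasoning
  reindex : ∀ k → k < suc (n ∸ c) → f′ (c + k ∸ c) * g (n ∸ (c + k)) ≡ f′ k * g ((n ∸ c) ∸ k)
  reindex k _ = cong₂ _*_ (cong f′ (m+n∸m≡n c k)) (cong g (sym (∸-+-assoc n c k)))

conv-stepʳ : ∀ c f g g′ → (∀ n → g′ n ≡ g n + [ c ≤ᵇ n ]× g′ (n ∸ c)) →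
  ∀ n → conv f g′ n ≡ conv f g n + [ c ≤ᵇ n ]× conv f g′ (n ∸ c)
conv-stepʳ c f g g′ rec n = begin
  conv f g′ n                                            ≡⟨ conv-comm f g′ n ⟩
  conv g′ f n                                            ≡⟨ conv-stepˡ c g g′ f rec n ⟩
  conv g f n + [ c ≤ᵇ n ]× conv g′ f (n ∸ c)
    ≡⟨ cong₂ (λ u v → u + [ c ≤ᵇ n ]× v) (conv-comm g f n) (conv-comm g′ f (n ∸ c)) ⟩
  conv f g n + [ c ≤ᵇ n ]× conv f g′ (n ∸ c)             ∎
  where open ≡-Reasoning

conv-≤-head : ∀ f g h c n → f 0 ≡ 1 → c + g n ≤ h n → (∀ L → g L ≤ h L) → c + conv f g n ≤ conv f h n
conv-≤-head f g h c n f0≡1 head rest = begin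
  c + conv f g n                                              ≡⟨ cong (c +_) (Σ<-unfoldˡ _ n) ⟩
  c + (f 0 * g n + Σ< (λ t → f (suc t) * g (n ∸ suc t)) n)   ≡⟨ +-assoc c _ _ ⟨
  c + f 0 * g n + Σ< (λ t → f (suc t) * g (n ∸ suc t)) n     ≤⟨ +-mono-≤ head′ (Σ<-mono n (λ t _ → *-monoʳ-≤ (f (suc t)) (rest (n ∸ suc t)))) ⟩
  f 0 * h n + Σ< (λ t → f (suc t) * h (n ∸ suc t)) n         ≡⟨ Σ<-unfoldˡ _ n ⟨
  conv f h n                                                  ∎
  where
  open ≤-Reasoning
  head′ : c + f 0 * g n ≤ f 0 * h n
  head′ rewrite f0≡1 | *-identityˡ (g n) | *-identityˡ (h n) = head

conv-+ʳ : ∀ f g h n → conv f (λ L → g L + h L) n ≡ conv f g n + conv f h n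
conv-+ʳ f g h n = trans (Σ<-cong (suc n) (λ t _ → *-distribˡ-+ (f t) _ _)) (Σ<-+ _ _ (suc n))

_∪_ : Pred → Pred → Pred
(P ∪ Q) x = P x ∨ Q x

Disjoint : Pred → Pred → Set
Disjoint P Q = ∀ x → P x ≡ true → Q x ≡ false

count-∪ : ∀ {P Q} → Disjoint P Q → ∀ m n → count (P ∪ Q) m n ≡ conv (count P m) (count Q m) n
count-∪ {P} {Q} P∩Q=∅ m n = go m n (<-wellFounded n)
  where
  R = P ∪ Q
  conv-count : ℕ → ℕ → ℕ
  conv-count m = conv (count P m) (count Q m)

  new-part : ∀ m n → count R m n ≡ conv-count m n → (suc m ≤ n → count R (suc m) (n ∸ suc m) ≡ conv-count (suc m) (n ∸ suc m)) →
    R (suc m) ≡ true → count R (suc m) n ≡ conv-count m n + [ suc m ≤ᵇ n ]× conv-count (suc m) (n ∸ suc m)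
  new-part m n ih ih′ R[c] = trans (count-suc-∈ R m R[c] n) (cong₂ _+_ ih ([≤ᵇ]×-cong ih′))

  step : ∀ m n → count R m n ≡ conv-count m n → (suc m ≤ n → count R (suc m) (n ∸ suc m) ≡ conv-count (suc m) (n ∸ suc m)) →
         count R (suc m) n ≡ conv-count (suc m) n
  step m n ih ih′ with P (suc m) in P[c] | Q (suc m) in Q[c]
  ... | true | _ = begin
    count R c n                                                   ≡⟨ new-part m n ih ih′ (cong (_∨ Q c) P[c]) ⟩
    conv (count P m) (count Q m) n + later
      ≡⟨ cong (_+ later) (conv-congʳ (count P m) (λ t → sym (count-skip Q m t (P∩Q=∅ c P[c]))) n) ⟩
    conv (count P m) (count Q c) n + later
      ≡⟨ conv-stepˡ c (count P m) (count P c) (count Q c) (count-suc-∈ P m P[c]) n ⟨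
    conv-count c n                                                ∎
    where
    open ≡-Reasoning
    c = suc m
    later = [ c ≤ᵇ n ]× conv-count c (n ∸ c)
  ... | false | true = begin
    count R c n                                                   ≡⟨ new-part m n ih ih′ (trans (cong (_∨ Q c) P[c]) Q[c]) ⟩
    conv (count P m) (count Q m) n + later
      ≡⟨ cong (_+ later) (conv-comm (count P m) (count Q m) n) ⟩
    conv (count Q m) (count P m) n + later
      ≡⟨ cong (_+ later) (conv-congʳ (count Q m) (λ t → sym (count-skip P m t P[c])) n) ⟩
    conv (count Q m) (count P c) n + later
      ≡⟨ cong (_+ later) (conv-comm (count Q m) (count P c) n) ⟩
    conv (count P c) (count Q m) n + later
      ≡⟨ conv-stepʳ c (count P c) (count Q m) (count Q c) (count-suc-∈ Q m Q[c]) n ⟨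
    conv-count c n                                                ∎
    where
    open ≡-Reasoning
    c = suc m
    later = [ c ≤ᵇ n ]× conv-count c (n ∸ c)
  ... | false | false = begin
    count R (suc m) n        ≡⟨ count-skip R m n (cong₂ _∨_ P[c] Q[c]) ⟩
    count R m n              ≡⟨ ih ⟩
    conv-count m n           ≡⟨ Σ<-cong (suc n) (λ t _ → sym (cong₂ _*_ (count-skip P m t P[c]) (count-skip Q m (n ∸ t) Q[c]))) ⟩
    conv-count (suc m) n     ∎
    where open ≡-Reasoning

  go : ∀ m n → Acc _<_ n → count R m n ≡ conv-count m n
  go zero zero _ = refl
  go zero (suc n) _ = sym (Σ<-≡0 (suc (suc n)) (λ { zero _ → refl ; (suc t) _ → refl }))
  go (suc m) n (acc rs) = step m n (go m n (acc rs)) (λ 1+m≤n → go (suc m) (n ∸ suc m) (rs (∸-monoʳ-< z<s 1+m≤n)))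

conv-count₀ : ∀ P g n → conv (count P 0) g n ≡ g n
conv-count₀ P g n = trans (Σ<-unfoldˡ _ n) (trans (cong (g n + 0 +_) (Σ<-≡0 n (λ _ _ → refl))) (trans (+-identityʳ _) (+-identityʳ _)))

-- Partitions of bounded size

count≤ : Pred → ℕ → ℕ → ℕ
count≤ P m T = Σ< (count P m) (suc T)

count≤-0 : ∀ P T → count≤ P 0 T ≡ 1
count≤-0 P T = trans (Σ<-unfoldˡ (count P 0) T) (cong suc (Σ<-≡0 T (λ _ _ → refl)))

count≤-cong : ∀ {P Q} → (∀ x → P x ≡ Q x) → ∀ m T → count≤ P m T ≡ count≤ Q m T
count≤-cong P≗Q m T = Σ<-cong (suc T) (λ n _ → count-cong P≗Q m n)

count≤-skip : ∀ P m T → P (suc m) ≡ false → count≤ P (suc m) T ≡ count≤ P m T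
count≤-skip P m T P[1+m] = Σ<-cong (suc T) (λ n _ → count-skip P m n P[1+m])

count≤-≤-suc : ∀ P m T → count≤ P m T ≤ count≤ P (suc m) T
count≤-≤-suc P m T = Σ<-mono (suc T) (λ n _ → count-≤-suc P m n)

count≤-suc : ∀ P m T →
  count≤ P (suc m) T ≡ count≤ P m T + [ P (suc m) ]× [ suc m ≤ᵇ T ]× count≤ P (suc m) (T ∸ suc m)
count≤-suc P m T = begin
  Σ< (count P c) (suc T)
    ≡⟨ Σ<-cong (suc T) (λ n _ → count-suc P m n) ⟩
  Σ< (λ n → count P m n + [ P c ]× [ c ≤ᵇ n ]× count P c (n ∸ c)) (suc T)
    ≡⟨ Σ<-+ (count P m) _ (suc T) ⟩
  count≤ P m T + Σ< (λ n → [ P c ]× [ c ≤ᵇ n ]× count P c (n ∸ c)) (suc T)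
    ≡⟨ cong (count≤ P m T +_) (Σ<-[]× (P c) _ (suc T)) ⟩
  count≤ P m T + [ P c ]× Σ< (λ n → [ c ≤ᵇ n ]× count P c (n ∸ c)) (suc T)
    ≡⟨ cong (λ v → count≤ P m T + [ P c ]× v) (Σ<-shiftˡ (λ n → count P c (n ∸ c)) c T) ⟩
  count≤ P m T + [ P c ]× [ c ≤ᵇ T ]× Σ< (λ k → count P c (c + k ∸ c)) (suc (T ∸ c))
    ≡⟨ cong (λ v → count≤ P m T + [ P c ]× [ c ≤ᵇ T ]× v) (Σ<-cong (suc (T ∸ c)) (λ k _ → cong (count P c) (m+n∸m≡n c k))) ⟩
  count≤ P m T + [ P c ]× [ c ≤ᵇ T ]× count≤ P c (T ∸ c) ∎
  where
  open ≡-Reasoning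
  c = suc m

count≤-none : ∀ P m T → (∀ D → 0 < D → D ≤ m → P D ≡ false) → count≤ P m T ≡ 1
count≤-none P zero T _ = count≤-0 P T
count≤-none P (suc m) T none =
  trans (count≤-skip P m T (none (suc m) z<s ≤-refl)) (count≤-none P m T (λ D 0<D D≤m → none D 0<D (m≤n⇒m≤1+n D≤m)))

count≤-above : ∀ P m T → (∀ D → P D ≡ true → T < D) → count≤ P m T ≡ 1
count≤-above P zero T _ = count≤-0 P T
count≤-above P (suc m) T above = begin
  count≤ P (suc m) T                                             ≡⟨ count≤-suc P m T ⟩
  count≤ P m T + [ P c ]× [ c ≤ᵇ T ]× count≤ P c (T ∸ c)         ≡⟨ cong (count≤ P m T +_) (no-room (P c) refl) ⟩
  count≤ P m T + 0                                               ≡⟨ +-identityʳ _ ⟩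
  count≤ P m T                                                   ≡⟨ count≤-above P m T above ⟩
  1                                                              ∎
  where
  open ≡-Reasoning
  c = suc m
  no-room : ∀ b → P c ≡ b → [ b ]× [ c ≤ᵇ T ]× count≤ P c (T ∸ c) ≡ 0
  no-room false _ = refl
  no-room true P[c] = [≤ᵇ]×-no _ (above c P[c])

count≤-suc-∈ : ∀ P m → P (suc m) ≡ true → ∀ T →
  count≤ P (suc m) T ≡ count≤ P m T + [ suc m ≤ᵇ T ]× count≤ P (suc m) (T ∸ suc m)
count≤-suc-∈ P m P[1+m] T =
  trans (count≤-suc P m T) (cong (λ b → count≤ P m T + [ b ]× [ suc m ≤ᵇ T ]× count≤ P (suc m) (T ∸ suc m)) P[1+m])

_above_ : Pred → ℕ → Pred
(X above s) d = X d ∧ (s <ᵇ d)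

above-⊆ : ∀ {X} s → (X above s) ⊆ X
above-⊆ {X} s D p = proj₁ (∧-true {X D} p)

above-< : ∀ {X s D} → (X above s) D ≡ true → s < D
above-< {X} {s} {D} p = <ᵇ-true⁻ (proj₂ (∧-true {X D} p))

-- bound m x T counts pairs (μ, ν) with μ a partition of some t ≤ x and ν a partition of size
-- ≤ T ∸ t into parts above x ∸ t.  Splitting off the smallest parts while their total stays ≤ x
-- embeds the partitions of size ≤ T into these pairs.
module SplitSmallest (X : Pred) where

  summand : ℕ → ℕ → ℕ → ℕ → ℕ
  summand m x T t = [ t ≤ᵇ T ]× (count X m t * count≤ (X above (x ∸ t)) m (T ∸ t))

  bound : ℕ → ℕ → ℕ → ℕ
  bound m x T = Σ< (summand m x T) (suc x)

  bound-skip : ∀ m x T → X (suc m) ≡ false → bound (suc m) x T ≡ bound m x T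
  bound-skip m x T X[c] = Σ<-cong (suc x) (λ t _ → cong ([ t ≤ᵇ T ]×_)
    (cong₂ _*_ (count-skip X m t X[c]) (count≤-skip (X above (x ∸ t)) m (T ∸ t) (cong (_∧ ((x ∸ t) <ᵇ suc m)) X[c]))))

  bound-suc-large : ∀ m x T → X (suc m) ≡ true → x < suc m →
    bound (suc m) x T ≡ bound m x T + [ suc m ≤ᵇ T ]× bound (suc m) x (T ∸ suc m)
  bound-suc-large m x T X[c] x<c = begin
    bound c x T
      ≡⟨ Σ<-cong (suc x) (λ t t≤x → split t (≤-<-trans (≤-pred t≤x) x<c)) ⟩
    Σ< (λ t → summand m x T t + [ c ≤ᵇ T ]× summand c x (T ∸ c) t) (suc x)
      ≡⟨ Σ<-+ _ _ (suc x) ⟩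
    bound m x T + Σ< (λ t → [ c ≤ᵇ T ]× summand c x (T ∸ c) t) (suc x)
      ≡⟨ cong (bound m x T +_) (Σ<-[]× (c ≤ᵇ T) _ (suc x)) ⟩
    bound m x T + [ c ≤ᵇ T ]× bound c x (T ∸ c) ∎
    where
    open ≡-Reasoning
    c = suc m
    split : ∀ t → t < c → summand c x T t ≡ summand m x T t + [ c ≤ᵇ T ]× summand c x (T ∸ c) t
    split t t<c = begin
      [ t ≤ᵇ T ]× (count X c t * count≤ Y c (T ∸ t))
        ≡⟨ cong (λ v → [ t ≤ᵇ T ]× (count X c t * v)) (count≤-suc-∈ Y m Y[c] (T ∸ t)) ⟩
      [ t ≤ᵇ T ]× (count X c t * (count≤ Y m (T ∸ t) + rest))
        ≡⟨ cong ([ t ≤ᵇ T ]×_) (*-distribˡ-+ (count X c t) _ _) ⟩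
      [ t ≤ᵇ T ]× (count X c t * count≤ Y m (T ∸ t) + count X c t * rest)
        ≡⟨ []×-+ (t ≤ᵇ T) _ _ ⟩
      [ t ≤ᵇ T ]× (count X c t * count≤ Y m (T ∸ t)) + [ t ≤ᵇ T ]× (count X c t * rest)
        ≡⟨ cong₂ _+_ (cong (λ v → [ t ≤ᵇ T ]× (v * count≤ Y m (T ∸ t))) (count-beyond X m t t<c)) later ⟩
      summand m x T t + [ c ≤ᵇ T ]× summand c x (T ∸ c) t ∎
      where
      Y = X above (x ∸ t)
      rest = [ c ≤ᵇ T ∸ t ]× count≤ Y c (T ∸ t ∸ c)
      Y[c] : Y c ≡ true
      Y[c] = cong₂ _∧_ X[c] (≤ᵇ-true (≤-<-trans (m∸n≤m x t) x<c))
      later : [ t ≤ᵇ T ]× (count X c t * rest) ≡ [ c ≤ᵇ T ]× summand c x (T ∸ c) t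
      later = begin
        [ t ≤ᵇ T ]× (count X c t * rest)
          ≡⟨ cong ([ t ≤ᵇ T ]×_) ([]×-*ʳ (c ≤ᵇ T ∸ t) (count X c t) (count≤ Y c (T ∸ t ∸ c))) ⟩
        [ t ≤ᵇ T ]× [ c ≤ᵇ T ∸ t ]× (count X c t * count≤ Y c (T ∸ t ∸ c))
          ≡⟨ [≤ᵇ]×-∸ t c T _ ⟩
        [ t + c ≤ᵇ T ]× (count X c t * count≤ Y c (T ∸ t ∸ c))
          ≡⟨ cong₂ (λ u v → [ u ≤ᵇ T ]× (count X c t * count≤ Y c v)) (+-comm t c) (∸-comm T t c) ⟩
        [ c + t ≤ᵇ T ]× (count X c t * count≤ Y c (T ∸ c ∸ t))
          ≡⟨ [≤ᵇ]×-∸ c t T _ ⟨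
        [ c ≤ᵇ T ]× summand c x (T ∸ c) t ∎

  bound-suc-small : ∀ m x T → X (suc m) ≡ true → suc m ≤ x →
    bound (suc m) x T ≡ Σ< (λ t → [ t ≤ᵇ T ]× (count X m t * count≤ (X above (x ∸ t)) (suc m) (T ∸ t))) (suc x)
                        + [ suc m ≤ᵇ T ]× bound (suc m) (x ∸ suc m) (T ∸ suc m)
  bound-suc-small m x T X[c] c≤x = begin
    bound c x T
      ≡⟨ Σ<-cong (suc x) (λ t _ → split t) ⟩
    Σ< (λ t → first t + [ c ≤ᵇ t ]× shifted t) (suc x)
      ≡⟨ Σ<-+ _ _ (suc x) ⟩
    Σ< first (suc x) + Σ< (λ t → [ c ≤ᵇ t ]× shifted t) (suc x)
      ≡⟨ cong (Σ< first (suc x) +_) (trans (Σ<-shiftˡ shifted c x) ([≤ᵇ]×-yes _ c≤x)) ⟩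
    Σ< first (suc x) + Σ< (λ k → shifted (c + k)) (suc (x ∸ c))
      ≡⟨ cong (Σ< first (suc x) +_) (trans (Σ<-cong (suc (x ∸ c)) (λ k _ → reindex k)) (Σ<-[]× (c ≤ᵇ T) _ (suc (x ∸ c)))) ⟩
    Σ< first (suc x) + [ c ≤ᵇ T ]× bound c (x ∸ c) (T ∸ c) ∎
    where
    open ≡-Reasoning
    c = suc m
    first : ℕ → ℕ
    first t = [ t ≤ᵇ T ]× (count X m t * count≤ (X above (x ∸ t)) c (T ∸ t))
    shifted : ℕ → ℕ
    shifted t = [ t ≤ᵇ T ]× (count X c (t ∸ c) * count≤ (X above (x ∸ t)) c (T ∸ t))
    split : ∀ t → summand c x T t ≡ first t + [ c ≤ᵇ t ]× shifted t
    split t = begin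
      [ t ≤ᵇ T ]× (count X c t * N)
        ≡⟨ cong (λ v → [ t ≤ᵇ T ]× (v * N)) (count-suc-∈ X m X[c] t) ⟩
      [ t ≤ᵇ T ]× ((count X m t + [ c ≤ᵇ t ]× count X c (t ∸ c)) * N)
        ≡⟨ cong ([ t ≤ᵇ T ]×_) (*-distribʳ-+ N (count X m t) _) ⟩
      [ t ≤ᵇ T ]× (count X m t * N + ([ c ≤ᵇ t ]× count X c (t ∸ c)) * N)
        ≡⟨ []×-+ (t ≤ᵇ T) _ _ ⟩
      first t + [ t ≤ᵇ T ]× (([ c ≤ᵇ t ]× count X c (t ∸ c)) * N)
        ≡⟨ cong (first t +_) (trans (cong ([ t ≤ᵇ T ]×_) ([]×-*ˡ (c ≤ᵇ t) _ _)) ([]×-comm (t ≤ᵇ T) (c ≤ᵇ t) _)) ⟩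
      first t + [ c ≤ᵇ t ]× shifted t ∎
      where N = count≤ (X above (x ∸ t)) c (T ∸ t)
    reindex : ∀ k → shifted (c + k) ≡ [ c ≤ᵇ T ]× summand c (x ∸ c) (T ∸ c) k
    reindex k = begin
      [ c + k ≤ᵇ T ]× (count X c (c + k ∸ c) * count≤ (X above (x ∸ (c + k))) c (T ∸ (c + k)))
        ≡⟨ cong (λ v → [ c + k ≤ᵇ T ]× v) (cong₂ _*_ (cong (count X c) (m+n∸m≡n c k))
             (cong₂ (λ u v → count≤ (X above u) c v) (sym (∸-+-assoc x c k)) (sym (∸-+-assoc T c k)))) ⟩
      [ c + k ≤ᵇ T ]× (count X c k * count≤ (X above (x ∸ c ∸ k)) c (T ∸ c ∸ k))
        ≡⟨ [≤ᵇ]×-∸ c k T _ ⟨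
      [ c ≤ᵇ T ]× summand c (x ∸ c) (T ∸ c) k ∎

  count≤-≤-bound : ∀ m x T → count≤ X m T ≤ bound m x T
  count≤-≤-bound m x T = go m T (<-wellFounded T) x
    where
    step : ∀ m T x → (∀ x → count≤ X m T ≤ bound m x T) →
           (∀ x → suc m ≤ T → count≤ X (suc m) (T ∸ suc m) ≤ bound (suc m) x (T ∸ suc m)) →
           count≤ X (suc m) T ≤ bound (suc m) x T
    step m T x ih ih′ with X (suc m) in X[c] | x <? suc m
    ... | false | _ = subst₂ _≤_ (sym (count≤-skip X m T X[c])) (sym (bound-skip m x T X[c])) (ih x)
    ... | true | yes x<c = begin
      count≤ X (suc m) T                                            ≡⟨ count≤-suc-∈ X m X[c] T ⟩
      count≤ X m T + [ suc m ≤ᵇ T ]× count≤ X (suc m) (T ∸ suc m)   ≤⟨ +-mono-≤ (ih x) ([≤ᵇ]×-monoʳ (ih′ x)) ⟩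
      bound m x T + [ suc m ≤ᵇ T ]× bound (suc m) x (T ∸ suc m)     ≡⟨ bound-suc-large m x T X[c] x<c ⟨
      bound (suc m) x T                                             ∎
      where open ≤-Reasoning
    ... | true | no x≮c = begin
      count≤ X (suc m) T
        ≡⟨ count≤-suc-∈ X m X[c] T ⟩
      count≤ X m T + [ suc m ≤ᵇ T ]× count≤ X (suc m) (T ∸ suc m)
        ≤⟨ +-mono-≤ (≤-trans (ih x) enlarge) ([≤ᵇ]×-monoʳ (ih′ (x ∸ suc m))) ⟩
      Σ< first (suc x) + [ suc m ≤ᵇ T ]× bound (suc m) (x ∸ suc m) (T ∸ suc m)
        ≡⟨ bound-suc-small m x T X[c] (≮⇒≥ x≮c) ⟨
      bound (suc m) x T ∎
      where
      open ≤-Reasoning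
      first : ℕ → ℕ
      first t = [ t ≤ᵇ T ]× (count X m t * count≤ (X above (x ∸ t)) (suc m) (T ∸ t))
      enlarge : bound m x T ≤ Σ< first (suc x)
      enlarge = Σ<-mono (suc x) (λ t _ → []×-mono (t ≤ᵇ T) (*-monoʳ-≤ (count X m t) (count≤-≤-suc (X above (x ∸ t)) m (T ∸ t))))

    go : ∀ m T → Acc _<_ T → ∀ x → count≤ X m T ≤ bound m x T
    go zero T _ x = subst (_≤ bound 0 x T) (sym (count≤-0 X T))
                          (≤-trans (≤-reflexive (sym (cong (1 *_) (count≤-0 (X above x) T)))) (term≤Σ< (summand 0 x T) {suc x} 0 z<s))
    go (suc m) T (acc rs) x = step m T x (go m T (acc rs)) (λ x′ c≤T → go (suc m) (T ∸ suc m) (rs (∸-monoʳ-< z<s c≤T)) x′)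

members : Pred → ℕ → ℕ → ℕ → ℕ
members X m₀ m L = card (λ D → (m₀ <ᵇ D) ∧ (X D ∧ (D ≤ᵇ L))) (suc m)

members-suc : ∀ X {m₀ m} L → m₀ ≤ m → members X m₀ (suc m) L ≡ members X m₀ m L + [ X (suc m) ]× [ suc m ≤ᵇ L ]× 1
members-suc X {m₀} {m} L m₀≤m = cong (members X m₀ m L +_) (begin
  [ (m₀ <ᵇ suc m) ∧ (X (suc m) ∧ (suc m ≤ᵇ L)) ]× 1   ≡⟨ cong (λ b → [ b ∧ (X (suc m) ∧ (suc m ≤ᵇ L)) ]× 1) (≤ᵇ-true (s≤s m₀≤m)) ⟩
  [ X (suc m) ∧ (suc m ≤ᵇ L) ]× 1                     ≡⟨ []×-∧ (X (suc m)) (suc m ≤ᵇ L) 1 ⟩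
  [ X (suc m) ]× [ suc m ≤ᵇ L ]× 1                    ∎)
  where open ≡-Reasoning

-- A partition with a part above m₀ is determined by its largest part D (a member of X
-- in (m₀, m]) together with the partition of size t ≤ T ∸ D that remains.
count≤-largest-part : ∀ X {m₀ m} → m₀ ≤ m → ∀ T →
  count≤ X m T ≤ count≤ X m₀ T + Σ< (λ t → count X m t * members X m₀ m (T ∸ t)) (suc T)
count≤-largest-part X {m₀} m₀≤m T = go (≤⇒≤′ m₀≤m)
  where
  go : ∀ {m} → m₀ ≤′ m → count≤ X m T ≤ count≤ X m₀ T + Σ< (λ t → count X m t * members X m₀ m (T ∸ t)) (suc T)
  go ≤′-refl = m≤m+n _ _
  go {suc m} (≤′-step m₀≤′m) = begin
    count≤ X c T
      ≡⟨ count≤-suc X m T ⟩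
    count≤ X m T + new
      ≤⟨ +-monoˡ-≤ new (go m₀≤′m) ⟩
    count≤ X m₀ T + Σ< (λ t → count X m t * members X m₀ m (T ∸ t)) (suc T) + new
      ≤⟨ +-monoˡ-≤ new (+-monoʳ-≤ (count≤ X m₀ T) (Σ<-mono (suc T) (λ t _ → *-monoˡ-≤ (members X m₀ m (T ∸ t)) (count-≤-suc X m t)))) ⟩
    count≤ X m₀ T + Σ< (λ t → count X c t * members X m₀ m (T ∸ t)) (suc T) + new
      ≡⟨ +-assoc (count≤ X m₀ T) _ new ⟩
    count≤ X m₀ T + (Σ< (λ t → count X c t * members X m₀ m (T ∸ t)) (suc T) + new)
      ≡⟨ cong (count≤ X m₀ T +_) absorb ⟩
    count≤ X m₀ T + Σ< (λ t → count X c t * members X m₀ c (T ∸ t)) (suc T) ∎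
    where
    open ≤-Reasoning
    c = suc m
    new = [ X c ]× [ c ≤ᵇ T ]× count≤ X c (T ∸ c)
    new-as-sum : Σ< (λ t → count X c t * [ X c ]× [ c ≤ᵇ T ∸ t ]× 1) (suc T) ≡ new
    new-as-sum = begin-equality
      Σ< (λ t → count X c t * [ X c ]× [ c ≤ᵇ T ∸ t ]× 1) (suc T)
        ≡⟨ Σ<-cong (suc T) (λ t _ → *-[]×[]×1 (X c) (c ≤ᵇ T ∸ t) (count X c t)) ⟩
      Σ< (λ t → [ X c ]× [ c ≤ᵇ T ∸ t ]× count X c t) (suc T)
        ≡⟨ Σ<-[]× (X c) _ (suc T) ⟩
      [ X c ]× Σ< (λ t → [ c ≤ᵇ T ∸ t ]× count X c t) (suc T)
        ≡⟨ cong ([ X c ]×_) (Σ<-shiftʳ (count X c) c T) ⟩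
      new ∎
    absorb : Σ< (λ t → count X c t * members X m₀ m (T ∸ t)) (suc T) + new
           ≡ Σ< (λ t → count X c t * members X m₀ c (T ∸ t)) (suc T)
    absorb = begin-equality
      Σ< (λ t → count X c t * members X m₀ m (T ∸ t)) (suc T) + new
        ≡⟨ cong (Σ< (λ t → count X c t * members X m₀ m (T ∸ t)) (suc T) +_) new-as-sum ⟨
      Σ< (λ t → count X c t * members X m₀ m (T ∸ t)) (suc T) + Σ< (λ t → count X c t * [ X c ]× [ c ≤ᵇ T ∸ t ]× 1) (suc T)
        ≡⟨ Σ<-+ _ _ (suc T) ⟨
      Σ< (λ t → count X c t * members X m₀ m (T ∸ t) + count X c t * [ X c ]× [ c ≤ᵇ T ∸ t ]× 1) (suc T)
        ≡⟨ Σ<-cong (suc T) (λ t _ → trans (cong (count X c t *_) (members-suc X (T ∸ t) (≤′⇒≤ m₀≤′m))) (*-distribˡ-+ (count X c t) _ _)) ⟨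
      Σ< (λ t → count X c t * members X m₀ c (T ∸ t)) (suc T) ∎

-- Spaced sets

Inside : Pred → ℕ → ℕ → Set
Inside Z lo len = ∀ {D} → Z D ≡ true → lo < D × D ≤ lo + len

Spaced : ℕ → Pred → Set
Spaced b Z = ∀ {D D′} → Z D ≡ true → Z D′ ≡ true → D < D′ → b + D ≤ D′

spaced-∧ : ∀ {b Z} (p : Pred) → Spaced b Z → Spaced b (λ D → Z D ∧ p D)
spaced-∧ {Z = Z} p spaced {D} {D′} Zp[D] Zp[D′] = spaced (proj₁ (∧-true {Z D} Zp[D])) (proj₁ (∧-true {Z D′} Zp[D′]))

⌈_/_⌉ : ℕ → (b : ℕ) → .{{NonZero b}} → ℕ
⌈ zero / b ⌉ = 0
⌈ suc n / b ⌉ = suc (n / b)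

module _ (b : ℕ) .{{_ : NonZero b}} where

  ⌈/⌉≤1 : ∀ {n} → n ≤ b → ⌈ n / b ⌉ ≤ 1
  ⌈/⌉≤1 {zero} _ = z≤n
  ⌈/⌉≤1 {suc n} n<b = ≤-reflexive (cong suc (m<n⇒m/n≡0 n<b))

  ⌈/⌉-big : ∀ {n} → b < n → ⌈ n / b ⌉ ≡ suc ⌈ (n ∸ b) / b ⌉
  ⌈/⌉-big {suc n} (s≤s b≤n) = trans (cong suc (m/n≡1+[m∸n]/n b≤n)) (cong (suc ∘ ⌈_/ b ⌉) (sym (+-∸-assoc 1 b≤n)))

  card-spaced-≤1 : ∀ Z lo N → Inside Z lo b → Spaced b Z → card Z N ≤ 1
  card-spaced-≤1 Z lo N inside spaced = card-≤1 Z N too-close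
    where
    too-close : ∀ {D D′} → Z D ≡ true → Z D′ ≡ true → D < D′ → ⊥
    too-close {D} {D′} Z[D] Z[D′] D<D′ = <-irrefl refl (begin-strict
      b + D    ≤⟨ spaced Z[D] Z[D′] D<D′ ⟩
      D′       ≤⟨ proj₂ (inside Z[D′]) ⟩
      lo + b   ≡⟨ +-comm lo b ⟩
      b + lo   <⟨ +-monoʳ-< b (proj₁ (inside Z[D])) ⟩
      b + D    ∎)
      where open ≤-Reasoning

  card-spaced : ∀ Z lo len N → Inside Z lo len → Spaced b Z → card Z N ≤ ⌈ len / b ⌉
  card-spaced Z lo len N = go Z lo len (<-wellFounded len)
    where
    go : ∀ Z lo len → Acc _<_ len → Inside Z lo len → Spaced b Z → card Z N ≤ ⌈ len / b ⌉
    go Z lo zero _ inside _ = ≤-reflexive (card-≡0 Z N empty)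
      where
      empty : ∀ D → Z D ≡ false
      empty D with Z D in Z[D]
      ... | false = refl
      ... | true = ⊥-elim (<⇒≱ (proj₁ (inside Z[D])) (subst (D ≤_) (+-identityʳ lo) (proj₂ (inside Z[D]))))
    go Z lo (suc l) (acc rs) inside spaced with suc l ≤? b
    ... | yes 1+l≤b = ≤-trans (card-spaced-≤1 Z lo N inside′ spaced) (s≤s z≤n)
      where
      inside′ : Inside Z lo b
      inside′ Z[D] = proj₁ (inside Z[D]) , ≤-trans (proj₂ (inside Z[D])) (+-monoʳ-≤ lo 1+l≤b)
    ... | no 1+l≰b = begin
      card Z N                   ≡⟨ card-split Z (λ D → D ≤ᵇ lo + b) N ⟩
      card Z₁ N + card Z₂ N      ≤⟨ +-mono-≤ (card-spaced-≤1 Z₁ lo N inside₁ (spaced-∧ (λ D → D ≤ᵇ lo + b) spaced))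
                                             (go Z₂ (lo + b) (suc l ∸ b) (rs shorter) inside₂ (spaced-∧ (λ D → not (D ≤ᵇ lo + b)) spaced)) ⟩
      suc ⌈ (suc l ∸ b) / b ⌉    ≡⟨ ⌈/⌉-big b<len ⟨
      ⌈ suc l / b ⌉              ∎
      where
      open ≤-Reasoning
      b<len = ≰⇒> 1+l≰b
      shorter : suc l ∸ b < suc l
      shorter = ∸-monoʳ-< (>-nonZero⁻¹ b) (<⇒≤ b<len)
      Z₁ Z₂ : Pred
      Z₁ D = Z D ∧ (D ≤ᵇ lo + b)
      Z₂ D = Z D ∧ not (D ≤ᵇ lo + b)
      inside₁ : Inside Z₁ lo b
      inside₁ {D} Z₁[D] = proj₁ (inside (proj₁ (∧-true Z₁[D]))) , ≤ᵇ-true⁻ (proj₂ (∧-true Z₁[D]))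
      inside₂ : Inside Z₂ (lo + b) (suc l ∸ b)
      inside₂ {D} Z₂[D] = beyond , subst (D ≤_) (trans (cong (lo +_) (sym (m+[n∸m]≡n (<⇒≤ b<len)))) (sym (+-assoc lo b _)))
                                            (proj₂ (inside (proj₁ (∧-true Z₂[D]))))
        where
        beyond : lo + b < D
        beyond with D ≤? lo + b
        ... | yes D≤ = ⊥-elim (not-¬ (sym (≤ᵇ-true D≤)) (sym (proj₂ (∧-true Z₂[D]))))
        ... | no D≰ = ≰⇒> D≰

module SmallParts (a b M : ℕ) (1<a : 1 < a) (a<b : a < b) (b≤M : b ≤ M) where

  Q₁ : Pred
  Q₁ x = (x ≡ᵇ 1) ∨ (x ≡ᵇ b)

  Qₐ : Pred
  Qₐ x = x ≡ᵇ a

  Q₂ : Pred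
  Q₂ = Qₐ ∪ Q₁

  φ : ℕ → ℕ
  φ = count Q₁ M

  ψ : ℕ → ℕ
  ψ = count Q₂ M

  1<b : 1 < b
  1<b = <-trans 1<a a<b

  instance
    b≢0 : NonZero b
    b≢0 = >-nonZero (<-trans z<s 1<b)

  Q₁-above-b : ∀ x → b < x → Q₁ x ≡ false
  Q₁-above-b x b<x = cong₂ _∨_ (≡ᵇ-false (>⇒≢ (<-trans 1<b b<x))) (≡ᵇ-false (>⇒≢ b<x))

  Q₂-above-b : ∀ x → b < x → Q₂ x ≡ false
  Q₂-above-b x b<x = cong₂ _∨_ (≡ᵇ-false (>⇒≢ (<-trans a<b b<x))) (Q₁-above-b x b<x)

  φ′ : ℕ → ℕ
  φ′ L = [ b ≤ᵇ L ]× φ (L ∸ b)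

  φ-rec : ∀ L → φ L ≡ suc (φ′ L)
  φ-rec L = begin
    φ L                                          ≡⟨ count-largest Q₁ (<-trans z<s 1<b) b≤M Q₁-b (λ x b<x _ → Q₁-above-b x b<x) L ⟩
    count Q₁ (b ∸ 1) L + [ b ≤ᵇ L ]× φ (L ∸ b)   ≡⟨ cong (_+ [ b ≤ᵇ L ]× φ (L ∸ b)) only-ones ⟩
    suc ([ b ≤ᵇ L ]× φ (L ∸ b))                  ∎
    where
    open ≡-Reasoning
    Q₁-b : Q₁ b ≡ true
    Q₁-b = trans (cong ((b ≡ᵇ 1) ∨_) (≡ᵇ-refl b)) (∨-zeroʳ _)
    between : ∀ x → 1 < x → x ≤ b ∸ 1 → Q₁ x ≡ false
    between x 1<x x≤b∸1 = cong₂ _∨_ (≡ᵇ-false (>⇒≢ 1<x)) (≡ᵇ-false (<⇒≢ (≤-<-trans x≤b∸1 (∸-monoʳ-< z<s (<⇒≤ 1<b)))))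
    only-ones : count Q₁ (b ∸ 1) L ≡ 1
    only-ones = trans (count-skip-range Q₁ L (∸-monoˡ-≤ 1 1<b) between) (count-ones Q₁ refl L)

  φ≡1+/ : ∀ L → φ L ≡ suc (L / b)
  φ≡1+/ L = go L (<-wellFounded L)
    where
    go : ∀ L → Acc _<_ L → φ L ≡ suc (L / b)
    go L (acc rs) with b ≤? L
    ... | yes b≤L = trans (φ-rec L) (cong suc (trans ([≤ᵇ]×-yes _ b≤L)
                      (trans (go (L ∸ b) (rs (∸-monoʳ-< (<-trans z<s 1<b) b≤L))) (sym (m/n≡1+[m∸n]/n b≤L)))))
    ... | no b≰L = trans (φ-rec L) (cong suc (trans ([≤ᵇ]×-no _ (≰⇒> b≰L)) (sym (m<n⇒m/n≡0 (≰⇒> b≰L)))))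

  φ≥1 : ∀ L → 1 ≤ φ L
  φ≥1 L = subst (1 ≤_) (sym (φ≡1+/ L)) (s≤s z≤n)

  φ-small : ∀ {L} → L < b → φ L ≡ 1
  φ-small {L} L<b = trans (φ≡1+/ L) (cong suc (m<n⇒m/n≡0 L<b))

  φ-big : ∀ {L} → b ≤ L → φ L ≡ suc (φ (L ∸ b))
  φ-big {L} b≤L = trans (φ-rec L) (cong suc ([≤ᵇ]×-yes _ b≤L))

  φ-+b : ∀ L → φ (L + b) ≡ suc (φ L)
  φ-+b L = trans (φ-big (m≤n+m b L)) (cong (suc ∘ φ) (m+n∸n≡m L b))

  φ-mono : ∀ {L L′} → L ≤ L′ → φ L ≤ φ L′
  φ-mono {L} {L′} L≤L′ = subst₂ _≤_ (sym (φ≡1+/ L)) (sym (φ≡1+/ L′)) (s≤s (/-monoˡ-≤ b L≤L′))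

  Qₐ∩Q₁=∅ : Disjoint Qₐ Q₁
  Qₐ∩Q₁=∅ x Qₐx = cong₂ _∨_ (≡ᵇ-false (λ x≡1 → >⇒≢ 1<a (trans (sym x≡a) x≡1))) (≡ᵇ-false (λ x≡b → <⇒≢ a<b (trans (sym x≡a) x≡b)))
    where
    x≡a : x ≡ a
    x≡a = ≡ᵇ⇒≡ x a (subst T (sym Qₐx) tt)

  ψ≡conv : ∀ L → ψ L ≡ conv (count Qₐ M) φ L
  ψ≡conv = count-∪ Qₐ∩Q₁=∅ M

  ψ-rec : ∀ L → ψ L ≡ φ L + [ a ≤ᵇ L ]× ψ (L ∸ a)
  ψ-rec L = begin
    ψ L                                                              ≡⟨ ψ≡conv L ⟩
    conv (count Qₐ M) φ L                                            ≡⟨ conv-stepˡ a (count Qₐ 0) (count Qₐ M) φ copies-of-a L ⟩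
    conv (count Qₐ 0) φ L + [ a ≤ᵇ L ]× conv (count Qₐ M) φ (L ∸ a)  ≡⟨ cong₂ (λ u v → u + [ a ≤ᵇ L ]× v) (conv-count₀ Qₐ φ L) (sym (ψ≡conv (L ∸ a))) ⟩
    φ L + [ a ≤ᵇ L ]× ψ (L ∸ a)                                      ∎
    where
    open ≡-Reasoning
    Qₐ-above-a : ∀ x → a < x → x ≤ M → Qₐ x ≡ false
    Qₐ-above-a x a<x _ = ≡ᵇ-false (>⇒≢ a<x)
    Qₐ-below-a : ∀ x → 0 < x → x ≤ a ∸ 1 → Qₐ x ≡ false
    Qₐ-below-a x _ x≤a∸1 = ≡ᵇ-false (<⇒≢ (≤-<-trans x≤a∸1 (∸-monoʳ-< z<s (<⇒≤ 1<a))))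
    copies-of-a : ∀ n → count Qₐ M n ≡ count Qₐ 0 n + [ a ≤ᵇ n ]× count Qₐ M (n ∸ a)
    copies-of-a n = trans (count-largest Qₐ (<-trans z<s 1<a) (≤-trans (<⇒≤ a<b) b≤M) (≡ᵇ-refl a) Qₐ-above-a n)
                          (cong (_+ [ a ≤ᵇ n ]× count Qₐ M (n ∸ a)) (count-skip-range Qₐ n z≤n Qₐ-below-a))

  φ≤ψ : ∀ L → φ L ≤ ψ L
  φ≤ψ L = subst (φ L ≤_) (sym (ψ-rec L)) (m≤m+n _ _)

  ψ≥1 : ∀ L → 1 ≤ ψ L
  ψ≥1 L = ≤-trans (φ≥1 L) (φ≤ψ L)

  ψ-big : ∀ {L} → a ≤ L → ψ L ≡ φ L + ψ (L ∸ a)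
  ψ-big {L} a≤L = trans (ψ-rec L) (cong (φ L +_) ([≤ᵇ]×-yes _ a≤L))

  φ′-offset-≤φ : ∀ {s} L → s < b → φ′ (s + L) ≤ φ L
  φ′-offset-≤φ {s} L s<b = ≤-trans ([]×-≤ _ _) (φ-mono (m≤n+o⇒m∸n≤o (s + L) b (+-monoˡ-≤ L (<⇒≤ s<b))))

  ψ-lower : ∀ {z} → 3 * a ≤ z → φ z + φ (z ∸ a) + 2 ≤ ψ z
  ψ-lower {z} 3a≤z = begin
    φ z + φ (z ∸ a) + 2                                                   ≡⟨ +-assoc (φ z) _ 2 ⟩
    φ z + (φ (z ∸ a) + 2)                                                 ≤⟨ +-monoʳ-≤ (φ z) (+-monoʳ-≤ (φ (z ∸ a)) (+-mono-≤ (φ≥1 _) (ψ≥1 _))) ⟩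
    φ z + (φ (z ∸ a) + (φ (z ∸ a ∸ a) + ψ (z ∸ a ∸ a ∸ a)))               ≡⟨ cong (λ v → φ z + (φ (z ∸ a) + v)) (ψ-big a≤z∸a∸a) ⟨
    φ z + (φ (z ∸ a) + ψ (z ∸ a ∸ a))                                     ≡⟨ cong (φ z +_) (ψ-big a≤z∸a) ⟨
    φ z + ψ (z ∸ a)                                                       ≡⟨ ψ-big a≤z ⟨
    ψ z                                                                   ∎
    where
    open ≤-Reasoning
    3a≡ : a + a + a ≡ 3 * a
    3a≡ = trans (+-assoc a a a) (cong (λ v → a + (a + v)) (sym (+-identityʳ a)))
    a≤z∸a∸a : a ≤ z ∸ a ∸ a
    a≤z∸a∸a = m+n≤o⇒m≤o∸n a (m+n≤o⇒m≤o∸n (a + a) (subst (_≤ z) (sym 3a≡) 3a≤z))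
    a≤z∸a : a ≤ z ∸ a
    a≤z∸a = ≤-trans a≤z∸a∸a (m∸n≤m (z ∸ a) a)
    a≤z : a ≤ z
    a≤z = ≤-trans a≤z∸a (m∸n≤m z a)

  ⌈/⌉≤φ : ∀ L → ⌈ L / b ⌉ ≤ φ L
  ⌈/⌉≤φ zero = z≤n
  ⌈/⌉≤φ (suc L) = subst (suc (L / b) ≤_) (sym (φ≡1+/ (suc L))) (s≤s (/-monoˡ-≤ b (n≤1+n L)))

  σ₂ : ℕ → ℕ
  σ₂ L = [ a ≤ᵇ L ]× φ (L ∸ a)

  ⌈/⌉-∸ : ∀ L → ⌈ (L ∸ (a ∸ 1)) / b ⌉ ≡ σ₂ L
  ⌈/⌉-∸ L with a ≤? L
  ... | yes a≤L = begin
    ⌈ (L ∸ (a ∸ 1)) / b ⌉    ≡⟨ cong ⌈_/ b ⌉ L∸[a∸1]≡1+[L∸a] ⟩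
    suc ((L ∸ a) / b)        ≡⟨ φ≡1+/ (L ∸ a) ⟨
    φ (L ∸ a)                ≡⟨ [≤ᵇ]×-yes _ a≤L ⟨
    [ a ≤ᵇ L ]× φ (L ∸ a)    ∎
    where
    open ≡-Reasoning
    L∸[a∸1]≡1+[L∸a] : L ∸ (a ∸ 1) ≡ suc (L ∸ a)
    L∸[a∸1]≡1+[L∸a] = trans (cong (suc L ∸_) (m+[n∸m]≡n (<⇒≤ 1<a))) (+-∸-assoc 1 a≤L)
  ... | no a≰L = trans (cong ⌈_/ b ⌉ (m≤n⇒m∸n≡0 L≤a∸1)) (sym ([≤ᵇ]×-no _ (≰⇒> a≰L)))
    where
    L≤a∸1 : L ≤ a ∸ 1
    L≤a∸1 = ≤-pred (subst (L <_) (sym (m+[n∸m]≡n (<⇒≤ 1<a))) (≰⇒> a≰L))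

  -- With a single part size c ≥ b available there are 1 + ⌊T / c⌋ ≤ φ T such partitions.
  count≤-one-size : ∀ X m → (∀ {D D′} → X D ≡ true → X D′ ≡ true → D < D′ → D′ ≤ m → ⊥) →
    (∀ {D} → X D ≡ true → b ≤ D) → ∀ T → count≤ X m T ≤ φ T
  count≤-one-size X zero _ _ T = subst (_≤ φ T) (sym (count≤-0 X T)) (φ≥1 T)
  count≤-one-size X (suc m) unique X≥b T with X (suc m) in X[c]
  ... | false = subst (_≤ φ T) (sym (count≤-skip X m T X[c]))
                      (count≤-one-size X m (λ p q D<D′ D′≤m → unique p q D<D′ (m≤n⇒m≤1+n D′≤m)) X≥b T)
  ... | true = go T (<-wellFounded T)
    where
    c = suc m
    none-below : ∀ D → 0 < D → D ≤ m → X D ≡ false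
    none-below D _ D≤m with X D in X[D]
    ... | false = refl
    ... | true = ⊥-elim (unique X[D] X[c] (s≤s D≤m) ≤-refl)
    go : ∀ T → Acc _<_ T → count≤ X c T ≤ φ T
    go T (acc rs) = begin
      count≤ X c T                                   ≡⟨ count≤-suc-∈ X m X[c] T ⟩
      count≤ X m T + [ c ≤ᵇ T ]× count≤ X c (T ∸ c)  ≡⟨ cong (_+ [ c ≤ᵇ T ]× count≤ X c (T ∸ c)) (count≤-none X m T none-below) ⟩
      suc ([ c ≤ᵇ T ]× count≤ X c (T ∸ c))           ≤⟨ copies ⟩
      φ T                                            ∎
      where
      open ≤-Reasoning
      copies : suc ([ c ≤ᵇ T ]× count≤ X c (T ∸ c)) ≤ φ T
      copies with c ≤? T
      ... | no c≰T = subst (λ v → suc v ≤ φ T) (sym ([≤ᵇ]×-no _ (≰⇒> c≰T))) (φ≥1 T)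
      ... | yes c≤T = begin
        suc ([ c ≤ᵇ T ]× count≤ X c (T ∸ c))  ≡⟨ cong suc ([≤ᵇ]×-yes _ c≤T) ⟩
        suc (count≤ X c (T ∸ c))              ≤⟨ s≤s (go (T ∸ c) (rs (∸-monoʳ-< z<s c≤T))) ⟩
        suc (φ (T ∸ c))                       ≤⟨ s≤s (φ-mono (∸-monoʳ-≤ T (X≥b X[c]))) ⟩
        suc (φ (T ∸ b))                       ≡⟨ φ-big (≤-trans (X≥b X[c]) c≤T) ⟨
        φ T                                   ∎

-- a, b, S stand for a₂, a₃ and A ∩ (a₃, ∞); F and P become p_A(· | no a₂'s) and p_A in SplitA.
module Inequality (a b M : ℕ) (1<a : 1 < a) (a<b : a < b) (b≤M : b ≤ M)
  (S : Pred) (S-above : ∀ {D} → S D ≡ true → b < D) (S-spaced : Spaced b S) where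

  open SmallParts a b M 1<a a<b b≤M

  e : ℕ → ℕ
  e = count S M

  G : ℕ → ℕ
  G = count≤ S M

  N : ℕ → ℕ → ℕ
  N s = count≤ (S above s) M

  F : ℕ → ℕ
  F = conv e φ

  P : ℕ → ℕ
  P = conv e ψ

  e0≡1 : e 0 ≡ 1
  e0≡1 = count-empty S M

  members-≤ : ∀ {X} → X ⊆ S → ∀ m₀ m L lo len →
    (∀ {D} → X D ≡ true → m₀ < D → D ≤ L → lo < D × D ≤ lo + len) → members X m₀ m L ≤ ⌈ len / b ⌉
  members-≤ {X} X⊆S m₀ m L lo len window = card-spaced b Z lo len (suc m) inside spaced
    where
    Z : Pred
    Z D = (m₀ <ᵇ D) ∧ (X D ∧ (D ≤ᵇ L))
    X-of : ∀ {D} → Z D ≡ true → X D ≡ true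
    X-of {D} p = proj₁ (∧-true {X D} (proj₂ (∧-true {m₀ <ᵇ D} p)))
    inside : Inside Z lo len
    inside {D} p = window (X-of p) (<ᵇ-true⁻ (proj₁ (∧-true {m₀ <ᵇ D} p))) (≤ᵇ-true⁻ (proj₂ (∧-true {X D} (proj₂ (∧-true {m₀ <ᵇ D} p)))))
    spaced : Spaced b Z
    spaced p q = S-spaced (X⊆S _ (X-of p)) (X⊆S _ (X-of q))

  N-bound : ∀ s y → N s (s + y) ≤ 1 + conv e (λ L → ⌈ L / b ⌉) y
  N-bound s y = begin
    count≤ X M n
      ≤⟨ count≤-largest-part X {0} {M} z≤n n ⟩
    count≤ X 0 n + Σ< (λ t → count X M t * members X 0 M (n ∸ t)) (suc n)
      ≡⟨ cong (_+ Σ< (λ t → count X M t * members X 0 M (n ∸ t)) (suc n)) (count≤-0 X n) ⟩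
    1 + Σ< (λ t → count X M t * members X 0 M (n ∸ t)) (suc n)
      ≤⟨ +-monoʳ-≤ 1 (Σ<-mono (suc n) (λ t _ → *-mono-≤ (count-mono (above-⊆ s) M t)
                                                         (members-≤ (above-⊆ s) 0 M (n ∸ t) s (y ∸ t) (window t)))) ⟩
    1 + Σ< (λ t → e t * ⌈ (y ∸ t) / b ⌉) (suc n)
      ≡⟨ cong (1 +_) (Σ<-truncate-* e _ (s≤s (m≤n+m y s)) (λ t y<t _ → cong ⌈_/ b ⌉ (m≤n⇒m∸n≡0 (<⇒≤ y<t)))) ⟩
    1 + conv e (λ L → ⌈ L / b ⌉) y ∎
    where
    open ≤-Reasoning
    X = S above s
    n = s + y
    window : ∀ t {D} → X D ≡ true → 0 < D → D ≤ n ∸ t → s < D × D ≤ s + (y ∸ t)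
    window t X[D] _ D≤ = above-< {S} X[D] , ≤-trans D≤ (+-∸-≤ s y t)

  N≤P : ∀ s {y} → a ≤ y → N s (s + y) ≤ P y
  N≤P s {y} a≤y = ≤-trans (N-bound s y) (conv-≤-head e (λ L → ⌈ L / b ⌉) ψ 1 y e0≡1 head (λ L → ≤-trans (⌈/⌉≤φ L) (φ≤ψ L)))
    where
    head : 1 + ⌈ y / b ⌉ ≤ ψ y
    head = subst₂ _≤_ (+-comm ⌈ y / b ⌉ 1) (sym (ψ-big a≤y)) (+-mono-≤ (⌈/⌉≤φ y) (ψ≥1 (y ∸ a)))

  G+P≤N+G*P : ∀ x {y} → a ≤ y → G (x + y) + P y ≤ N x (x + y) + G x * P y
  G+P≤N+G*P x {y} a≤y = begin
    G (x + y) + P y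
      ≤⟨ +-monoˡ-≤ (P y) (SplitSmallest.count≤-≤-bound S M x (x + y)) ⟩
    SplitSmallest.bound S M x (x + y) + P y
      ≡⟨ cong (_+ P y) (Σ<-unfoldˡ _ x) ⟩
    e 0 * N x (x + y) + Σ< (λ t → [ suc t ≤ᵇ x + y ]× (e (suc t) * N (x ∸ suc t) (x + y ∸ suc t))) x + P y
      ≤⟨ +-monoˡ-≤ (P y) (+-mono-≤ (≤-reflexive (trans (cong (_* N x (x + y)) e0≡1) (*-identityˡ _))) (Σ<-mono x later)) ⟩
    N x (x + y) + Σ< (λ t → e (suc t) * P y) x + P y
      ≡⟨ +-assoc (N x (x + y)) _ _ ⟩
    N x (x + y) + (Σ< (λ t → e (suc t) * P y) x + P y)
      ≡⟨ cong (N x (x + y) +_) G*P ⟩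
    N x (x + y) + G x * P y ∎
    where
    open ≤-Reasoning
    later : ∀ t → t < x → [ suc t ≤ᵇ x + y ]× (e (suc t) * N (x ∸ suc t) (x + y ∸ suc t)) ≤ e (suc t) * P y
    later t t<x = ≤-trans ([]×-≤ _ _) (*-monoʳ-≤ (e (suc t))
                    (subst (λ v → N (x ∸ suc t) v ≤ P y) (sym (+-∸-comm y t<x)) (N≤P (x ∸ suc t) a≤y)))
    G*P : Σ< (λ t → e (suc t) * P y) x + P y ≡ G x * P y
    G*P = begin-equality
      Σ< (λ t → e (suc t) * P y) x + P y        ≡⟨ +-comm _ (P y) ⟩
      P y + Σ< (λ t → e (suc t) * P y) x        ≡⟨ cong₂ _+_ (sym (trans (cong (_* P y) e0≡1) (*-identityˡ _))) (Σ<-*ʳ (λ t → e (suc t)) (P y) x) ⟩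
      e 0 * P y + Σ< (λ t → e (suc t)) x * P y  ≡⟨ *-distribʳ-+ (P y) (e 0) _ ⟨
      (e 0 + Σ< (λ t → e (suc t)) x) * P y      ≡⟨ cong (_* P y) (Σ<-unfoldˡ e x) ⟨
      G x * P y                                 ∎

  G-submult : ∀ x {y} → a ≤ y → G (x + y) ≤ G x * P y
  G-submult x {y} a≤y = +-cancelʳ-≤ (P y) _ _ (begin
    G (x + y) + P y          ≤⟨ G+P≤N+G*P x a≤y ⟩
    N x (x + y) + G x * P y  ≤⟨ +-monoˡ-≤ (G x * P y) (N≤P x a≤y) ⟩
    P y + G x * P y          ≡⟨ +-comm (P y) _ ⟩
    G x * P y + P y          ∎)
    where open ≤-Reasoning

  G≡conv : ∀ n → G n ≡ conv e (λ _ → 1) n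
  G≡conv n = Σ<-cong (suc n) (λ t _ → sym (*-identityʳ (e t)))

  F-split : ∀ n → F n ≡ G n + conv e φ′ n
  F-split n = trans (conv-congʳ e φ-rec n) (trans (conv-+ʳ e (λ _ → 1) φ′ n) (cong (_+ conv e φ′ n) (sym (G≡conv n))))

  conv-φ′ : ∀ n → conv e φ′ n ≡ [ b ≤ᵇ n ]× F (n ∸ b)
  conv-φ′ n = trans (Σ<-cong (suc n) (λ t _ → trans ([]×-*ʳ (b ≤ᵇ n ∸ t) (e t) _) (cong (λ v → [ b ≤ᵇ n ∸ t ]× (e t * φ v)) (∸-comm n t b))))
                    (Σ<-shiftʳ (λ t → e t * φ (n ∸ b ∸ t)) b n)

  F-rec : ∀ n → F n ≡ G n + [ b ≤ᵇ n ]× F (n ∸ b)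
  F-rec n = trans (F-split n) (cong (G n +_) (conv-φ′ n))

  F-rec-≥ : ∀ {n} → b ≤ n → F n ≡ G n + F (n ∸ b)
  F-rec-≥ {n} b≤n = trans (F-rec n) (cong (G n +_) ([≤ᵇ]×-yes _ b≤n))

  G-small : ∀ {s} → s < b → G s ≡ 1
  G-small {s} s<b = count≤-above S M s (λ D S[D] → <-trans s<b (S-above S[D]))

  F-small : ∀ {s} → s < b → F s ≡ 1
  F-small {s} s<b = trans (F-rec s) (cong₂ _+_ (G-small s<b) ([≤ᵇ]×-no _ s<b))

  -- Split at m₀ = w + (a ∸ 1): below m₀, S offers at most one part size (its spacing b exceeds
  -- a ∸ 1), which gives φ; a largest part above m₀ leaves weight ⌈ (z ∸ t ∸ (a ∸ 1)) / b ⌉ = σ₂ (z ∸ t).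
  N-bound-sharp : ∀ {w z} → a ∸ 1 ≤ z → w + z ≤ M → N w (w + z) ≤ φ (w + z) + conv e σ₂ z
  N-bound-sharp {w} {z} a∸1≤z w+z≤M = begin
    count≤ X M n
      ≤⟨ count≤-largest-part X m₀≤M n ⟩
    count≤ X m₀ n + Σ< (λ t → count X M t * members X m₀ M (n ∸ t)) (suc n)
      ≤⟨ +-mono-≤ (count≤-one-size X m₀ unique (λ X[D] → <⇒≤ (S-above (proj₁ (∧-true X[D])))) n)
                  (Σ<-mono (suc n) (λ t _ → *-mono-≤ (count-mono (above-⊆ w) M t) (members-≤ (above-⊆ w) m₀ M (n ∸ t) m₀ (n ∸ t ∸ m₀) (window t)))) ⟩
    φ n + Σ< (λ t → e t * ⌈ (n ∸ t ∸ m₀) / b ⌉) (suc n)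
      ≡⟨ cong (φ n +_) (Σ<-truncate-* e _ (s≤s (m≤n+m z w)) (λ t z<t _ → cong ⌈_/ b ⌉ (m≤n⇒m∸n≡0 (too-small t z<t)))) ⟩
    φ n + Σ< (λ t → e t * ⌈ (n ∸ t ∸ m₀) / b ⌉) (suc z)
      ≡⟨ cong (φ n +_) (Σ<-cong (suc z) (λ t t≤z → cong (e t *_) (trans (cong ⌈_/ b ⌉ (shift t (≤-pred t≤z))) (⌈/⌉-∸ (z ∸ t))))) ⟩
    φ n + conv e σ₂ z ∎
    where
    open ≤-Reasoning
    X = S above w
    n = w + z
    m₀ = w + (a ∸ 1)
    m₀≤M : m₀ ≤ M
    m₀≤M = ≤-trans (+-monoʳ-≤ w a∸1≤z) w+z≤M
    unique : ∀ {D D′} → X D ≡ true → X D′ ≡ true → D < D′ → D′ ≤ m₀ → ⊥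
    unique {D} {D′} X[D] X[D′] D<D′ D′≤m₀ = <-irrefl refl (begin-strict
      b + D     ≤⟨ S-spaced (proj₁ (∧-true X[D])) (proj₁ (∧-true X[D′])) D<D′ ⟩
      D′        ≤⟨ D′≤m₀ ⟩
      w + (a ∸ 1) <⟨ +-monoʳ-< w (≤-trans (∸-monoʳ-< z<s (<⇒≤ 1<a)) (<⇒≤ a<b)) ⟩
      w + b     ≡⟨ +-comm w b ⟩
      b + w     <⟨ +-monoʳ-< b (above-< {S} X[D]) ⟩
      b + D     ∎)
    window : ∀ t {D} → X D ≡ true → m₀ < D → D ≤ n ∸ t → m₀ < D × D ≤ m₀ + (n ∸ t ∸ m₀)
    window t _ m₀<D D≤ = m₀<D , ≤-trans D≤ (m≤n+m∸n _ m₀)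
    too-small : ∀ t → z < t → n ∸ t ≤ m₀
    too-small t z<t = ≤-trans (m≤n+o⇒m∸n≤o n t (subst (_≤ t + w) (+-comm z w) (+-monoˡ-≤ w (<⇒≤ z<t)))) (m≤m+n w (a ∸ 1))
    shift : ∀ t → t ≤ z → n ∸ t ∸ m₀ ≡ z ∸ t ∸ (a ∸ 1)
    shift t t≤z = trans (cong (_∸ m₀) (+-∸-assoc w t≤z)) ([m+n]∸[m+o]≡n∸o w (z ∸ t) (a ∸ 1))

  G-bound : ∀ {s} z → s < b → G (s + z) ≤ 1 + conv e (λ L → ⌈ L / b ⌉) z
  G-bound {s} z s<b = subst (_≤ 1 + conv e (λ L → ⌈ L / b ⌉) z) (sym (count≤-cong S≗S-above M (s + z))) (N-bound s z)
    where
    S≗S-above : ∀ D → S D ≡ (S above s) D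
    S≗S-above D with S D in S[D]
    ... | false = refl
    ... | true = sym (≤ᵇ-true (<-trans s<b (S-above S[D])))

  conv-φ′-offset : ∀ {s} z → s < b → conv e φ′ (s + z) ≡ conv e (λ L → φ′ (s + L)) z
  conv-φ′-offset {s} z s<b = begin
    conv e φ′ (s + z)
      ≡⟨ Σ<-truncate-* e _ (s≤s (m≤n+m z s)) (λ t z<t _ → [≤ᵇ]×-no _ (too-short t z<t)) ⟩
    Σ< (λ t → e t * φ′ (s + z ∸ t)) (suc z)
      ≡⟨ Σ<-cong (suc z) (λ t t≤z → cong (λ v → e t * φ′ v) (+-∸-assoc s (≤-pred t≤z))) ⟩
    conv e (λ L → φ′ (s + L)) z ∎
    where
    open ≡-Reasoning
    too-short : ∀ t → z < t → s + z ∸ t < b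
    too-short t z<t = ≤-<-trans (m≤n+o⇒m∸n≤o (s + z) t (subst (_≤ t + s) (+-comm z s) (+-monoˡ-≤ s (<⇒≤ z<t)))) s<b

  W : ℕ → ℕ → ℕ
  W s L = ⌈ L / b ⌉ + φ′ (s + L) + σ₂ L

  W-bound : ∀ {s} L → s < b → W s L ≤ ψ L + ψ L
  W-bound {s} L s<b with a ≤? L
  ... | yes a≤L = begin
    ⌈ L / b ⌉ + φ′ (s + L) + σ₂ L
      ≤⟨ +-mono-≤ (+-mono-≤ (⌈/⌉≤φ L) (φ′-offset-≤φ L s<b)) (≤-reflexive ([≤ᵇ]×-yes _ a≤L)) ⟩
    φ L + φ L + φ (L ∸ a)            ≤⟨ +-monoʳ-≤ (φ L + φ L) (φ≤ψ (L ∸ a)) ⟩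
    φ L + φ L + ψ (L ∸ a)            ≡⟨ +-assoc (φ L) (φ L) _ ⟩
    φ L + (φ L + ψ (L ∸ a))          ≡⟨ cong (φ L +_) (ψ-big a≤L) ⟨
    φ L + ψ L                        ≤⟨ +-monoˡ-≤ (ψ L) (φ≤ψ L) ⟩
    ψ L + ψ L                        ∎
    where open ≤-Reasoning
  ... | no a≰L = begin
    ⌈ L / b ⌉ + φ′ (s + L) + σ₂ L
      ≤⟨ +-mono-≤ (+-mono-≤ (⌈/⌉≤1 b (<⇒≤ (<-trans L<a a<b))) φ′≤1) (≤-reflexive ([≤ᵇ]×-no _ L<a)) ⟩
    1 + 1 + 0                        ≤⟨ +-mono-≤ (+-mono-≤ (ψ≥1 L) (ψ≥1 L)) z≤n ⟩
    ψ L + ψ L + 0                    ≡⟨ +-identityʳ _ ⟩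
    ψ L + ψ L                        ∎
    where
    open ≤-Reasoning
    L<a = ≰⇒> a≰L
    φ′≤1 : φ′ (s + L) ≤ 1
    φ′≤1 = ≤-trans ([]×-≤ _ _) (≤-reflexive (φ-small (m<n+o⇒m∸n<o (s + L) b (+-mono-< s<b (<-trans L<a a<b)))))

  -- Only here is z ≥ 3a needed: ψ z ≥ φ z + φ (z ∸ a) + 2 absorbs the extra 1 + φ (s + b + z).
  head-bound : ∀ {s z} → s < b → 3 * a ≤ z → 1 + φ (s + b + z) + W s z ≤ ψ z + ψ z
  head-bound {s} {z} s<b 3a≤z = begin
    1 + φ (s + b + z) + W s z                  ≤⟨ +-mono-≤ (+-monoʳ-≤ 1 φ-top) W-top ⟩
    1 + (2 + p) + (p + p + q)                  ≤⟨ +-monoʳ-≤ (1 + (2 + p)) (+-monoˡ-≤ q (+-monoʳ-≤ p p≤1+q)) ⟩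
    1 + (2 + p) + (p + (1 + q) + q)            ≡⟨ rearrange p q ⟩
    (p + q + 2) + (p + q + 2)                  ≤⟨ +-mono-≤ (ψ-lower 3a≤z) (ψ-lower 3a≤z) ⟩
    ψ z + ψ z                                  ∎
    where
    open ≤-Reasoning
    p = φ z
    q = φ (z ∸ a)
    rearrange : ∀ p q → 1 + (2 + p) + (p + (1 + q) + q) ≡ (p + q + 2) + (p + q + 2)
    rearrange = solve-∀
    a≤z : a ≤ z
    a≤z = ≤-trans (m≤m+n a _) 3a≤z
    φ-top : φ (s + b + z) ≤ 2 + p
    φ-top = begin
      φ (s + b + z)    ≡⟨ cong φ (xy∙z≈xz∙y s b z) ⟩
      φ (s + z + b)    ≡⟨ φ-+b (s + z) ⟩
      suc (φ (s + z))  ≤⟨ s≤s (φ-mono (subst (s + z ≤_) (+-comm b z) (+-monoˡ-≤ z (<⇒≤ s<b)))) ⟩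
      suc (φ (z + b))  ≡⟨ cong suc (φ-+b z) ⟩
      2 + p            ∎
    W-top : W s z ≤ p + p + q
    W-top = +-mono-≤ (+-mono-≤ (⌈/⌉≤φ z) (φ′-offset-≤φ z s<b)) (≤-reflexive ([≤ᵇ]×-yes _ a≤z))
    p≤1+q : p ≤ 1 + q
    p≤1+q = begin
      φ z                    ≤⟨ φ-mono (subst (_≤ z ∸ a + b) (m∸n+n≡m a≤z) (+-monoʳ-≤ (z ∸ a) (<⇒≤ a<b))) ⟩
      φ (z ∸ a + b)          ≡⟨ φ-+b (z ∸ a) ⟩
      1 + q                  ∎

  -- All three pieces are bounded by convolutions with e, whose weights add up to W s ≤ 2ψ.
  base-bound : ∀ {s z} → s < b → 3 * a ≤ z → s + b + z ≤ M → F (s + z) + N (s + b) (s + b + z) ≤ P z + P z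
  base-bound {s} {z} s<b 3a≤z s+b+z≤M = begin
    F (s + z) + N w (w + z)
      ≡⟨ cong (_+ N w (w + z)) (F-split (s + z)) ⟩
    G (s + z) + conv e φ′ (s + z) + N w (w + z)
      ≤⟨ +-mono-≤ (+-mono-≤ (G-bound z s<b) (≤-reflexive (conv-φ′-offset z s<b))) (N-bound-sharp a∸1≤z s+b+z≤M) ⟩
    1 + C₁ + C₂ + (φ (w + z) + C₃)
      ≡⟨ rearrange 1 C₁ C₂ (φ (w + z)) C₃ ⟩
    1 + φ (w + z) + (C₁ + C₂ + C₃)
      ≡⟨ cong (1 + φ (w + z) +_) W-split ⟨
    1 + φ (w + z) + conv e (W s) z
      ≤⟨ conv-≤-head e (W s) (λ L → ψ L + ψ L) (1 + φ (w + z)) z e0≡1 (head-bound s<b 3a≤z) (λ L → W-bound L s<b) ⟩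
    conv e (λ L → ψ L + ψ L) z
      ≡⟨ conv-+ʳ e ψ ψ z ⟩
    P z + P z ∎
    where
    open ≤-Reasoning
    w = s + b
    C₁ = conv e (λ L → ⌈ L / b ⌉) z
    C₂ = conv e (λ L → φ′ (s + L)) z
    C₃ = conv e σ₂ z
    rearrange : ∀ u c₁ c₂ v c₃ → u + c₁ + c₂ + (v + c₃) ≡ u + v + (c₁ + c₂ + c₃)
    rearrange = solve-∀
    W-split : conv e (W s) z ≡ C₁ + C₂ + C₃
    W-split = trans (conv-+ʳ e (λ L → ⌈ L / b ⌉ + φ′ (s + L)) σ₂ z) (cong (_+ C₃) (conv-+ʳ e (λ L → ⌈ L / b ⌉) (λ L → φ′ (s + L)) z))
    a∸1≤z : a ∸ 1 ≤ z
    a∸1≤z = ≤-trans (m∸n≤m a 1) (≤-trans (m≤m+n a _) 3a≤z)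

  F-submult-base : ∀ {s z} → s < b → 3 * a ≤ z → s + b + z ≤ M → F (s + b + z) ≤ F (s + b) * P z
  F-submult-base {s} {z} s<b 3a≤z s+b+z≤M = +-cancelʳ-≤ (P z + P z) _ _ (begin
    F (w + z) + (P z + P z)                          ≡⟨ cong (_+ (P z + P z)) F[w+z] ⟩
    G (w + z) + F (s + z) + (P z + P z)              ≡⟨ rearrange₁ (G (w + z)) (F (s + z)) (P z) ⟩
    (G (w + z) + P z) + (F (s + z) + P z)            ≤⟨ +-monoˡ-≤ (F (s + z) + P z) (G+P≤N+G*P w a≤z) ⟩
    (N w (w + z) + G w * P z) + (F (s + z) + P z)    ≡⟨ rearrange₂ (N w (w + z)) (G w * P z) (F (s + z)) (P z) ⟩
    (F (s + z) + N w (w + z)) + (G w * P z + P z)    ≤⟨ +-monoˡ-≤ (G w * P z + P z) (base-bound s<b 3a≤z s+b+z≤M) ⟩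
    (P z + P z) + (G w * P z + P z)                  ≡⟨ rearrange₃ (G w) (P z) ⟩
    (G w + 1) * P z + (P z + P z)                    ≡⟨ cong (λ v → v * P z + (P z + P z)) F[w] ⟨
    F w * P z + (P z + P z)                          ∎)
    where
    open ≤-Reasoning
    w = s + b
    a≤z : a ≤ z
    a≤z = ≤-trans (m≤m+n a _) 3a≤z
    F[w] : F w ≡ G w + 1
    F[w] = trans (F-rec-≥ (m≤n+m b s)) (cong (G w +_) (trans (cong F (m+n∸n≡m s b)) (F-small s<b)))
    F[w+z] : F (w + z) ≡ G (w + z) + F (s + z)
    F[w+z] = trans (F-rec-≥ (≤-trans (m≤n+m b s) (m≤m+n w z))) (cong (λ v → G (w + z) + F v) (trans (cong (_∸ b) (xy∙z≈xz∙y s b z)) (m+n∸n≡m (s + z) b)))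
    rearrange₁ : ∀ g f p → g + f + (p + p) ≡ (g + p) + (f + p)
    rearrange₁ = solve-∀
    rearrange₂ : ∀ n gp f p → (n + gp) + (f + p) ≡ (f + n) + (gp + p)
    rearrange₂ = solve-∀
    rearrange₃ : ∀ g p → (p + p) + (g * p + p) ≡ (g + 1) * p + (p + p)
    rearrange₃ = solve-∀

  F-submult : ∀ {w z} → b ≤ w → 3 * a ≤ z → w + z ≤ M → F (w + z) ≤ F w * P z
  F-submult {w} {z} b≤w 3a≤z w+z≤M = go w (<-wellFounded w) b≤w w+z≤M
    where
    go : ∀ w → Acc _<_ w → b ≤ w → w + z ≤ M → F (w + z) ≤ F w * P z
    go w (acc rs) b≤w w+z≤M with b ≤? w ∸ b
    ... | yes b≤w∸b = begin
      F (w + z)                    ≡⟨ F-rec-≥ (≤-trans b≤w (m≤m+n w z)) ⟩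
      G (w + z) + F (w + z ∸ b)    ≡⟨ cong (λ v → G (w + z) + F v) (+-∸-comm z b≤w) ⟩
      G (w + z) + F (w ∸ b + z)    ≤⟨ +-mono-≤ (G-submult w (≤-trans (m≤m+n a _) 3a≤z)) (go (w ∸ b) (rs shorter) b≤w∸b w∸b+z≤M) ⟩
      G w * P z + F (w ∸ b) * P z  ≡⟨ *-distribʳ-+ (P z) (G w) _ ⟨
      (G w + F (w ∸ b)) * P z      ≡⟨ cong (_* P z) (F-rec-≥ b≤w) ⟨
      F w * P z                    ∎
      where
      open ≤-Reasoning
      shorter : w ∸ b < w
      shorter = ∸-monoʳ-< (<-trans z<s 1<b) b≤w
      w∸b+z≤M : w ∸ b + z ≤ M
      w∸b+z≤M = ≤-trans (+-monoˡ-≤ z (m∸n≤m w b)) w+z≤M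
    ... | no b≰w∸b = subst (λ v → F (v + z) ≤ F v * P z) (m∸n+n≡m b≤w)
                           (F-submult-base (≰⇒> b≰w∸b) 3a≤z (subst (λ v → v + z ≤ M) (sym (m∸n+n≡m b≤w)) w+z≤M))

-- All counts use parts ≤ M, which by count-stable loses nothing for sizes ≤ M.
module SplitA (A : Pred) (a₂ a₃ M : ℕ)
  (A0 : A 0 ≡ false) (A1 : A 1 ≡ true) (1<a₂ : 1 < a₂) (a₂<a₃ : a₂ < a₃) (Aa₂ : A a₂ ≡ true) (Aa₃ : A a₃ ≡ true)
  (gap₁ : ∀ x → 1 < x → x < a₂ → A x ≡ false) (gap₂ : ∀ x → a₂ < x → x < a₃ → A x ≡ false)
  (sparse : ∀ x y → A x ≡ true → A y ≡ true → a₃ < y → y < x → a₃ + y ≤ x) (a₃≤M : a₃ ≤ M) where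

  S : Pred
  S x = A x ∧ (a₃ <ᵇ x)

  S-above : ∀ {x} → S x ≡ true → a₃ < x
  S-above {x} S[x] = <ᵇ-true⁻ (proj₂ (∧-true {A x} S[x]))

  S-spaced : Spaced a₃ S
  S-spaced {x} {y} S[x] S[y] x<y = sparse y x (proj₁ (∧-true {A y} S[y])) (proj₁ (∧-true {A x} S[x])) (S-above S[x]) x<y

  open Inequality a₂ a₃ M 1<a₂ a₂<a₃ a₃≤M S S-above S-spaced public
  open SmallParts a₂ a₃ M 1<a₂ a₂<a₃ a₃≤M

  S-below : ∀ {x} → x ≤ a₃ → S x ≡ false
  S-below {x} x≤a₃ = trans (cong (A x ∧_) (≤ᵇ-false (s≤s x≤a₃))) (∧-zeroʳ (A x))

  S-above≡A : ∀ {x} → a₃ < x → S x ≡ A x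
  S-above≡A {x} a₃<x = trans (cong (A x ∧_) (≤ᵇ-true a₃<x)) (∧-identityʳ (A x))

  Q₂-other : ∀ {x} → x ≢ a₂ → x ≢ 1 → x ≢ a₃ → Q₂ x ≡ false
  Q₂-other x≢a₂ x≢1 x≢a₃ = cong₂ _∨_ (≡ᵇ-false x≢a₂) (cong₂ _∨_ (≡ᵇ-false x≢1) (≡ᵇ-false x≢a₃))

  A-below : ∀ x → x < a₃ → A x ≡ Q₂ x
  A-below x x<a₃ with <-cmp x a₂
  ... | tri> _ _ a₂<x = trans (gap₂ x a₂<x x<a₃) (sym (Q₂-other (>⇒≢ a₂<x) (>⇒≢ (<-trans 1<a₂ a₂<x)) (<⇒≢ x<a₃)))
  ... | tri≈ _ refl _ = trans Aa₂ (sym (cong (_∨ Q₁ x) (≡ᵇ-refl x)))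
  ... | tri< x<a₂ _ _ = small x x<a₂
    where
    small : ∀ x → x < a₂ → A x ≡ Q₂ x
    small zero 0<a₂ = trans A0 (sym (Q₂-other (<⇒≢ 0<a₂) (λ ()) (<⇒≢ (<-trans 0<a₂ a₂<a₃))))
    small (suc zero) _ = trans A1 (sym (∨-zeroʳ (1 ≡ᵇ a₂)))
    small x@(suc (suc _)) x<a₂ = trans (gap₁ x (s≤s (s≤s z≤n)) x<a₂) (sym (Q₂-other (<⇒≢ x<a₂) (λ ()) (<⇒≢ (<-trans x<a₂ a₂<a₃))))

  A-split : ∀ x → A x ≡ S x ∨ Q₂ x
  A-split x with <-cmp a₃ x
  ... | tri< a₃<x _ _ = sym (trans (cong₂ _∨_ (S-above≡A a₃<x) (Q₂-above-b x a₃<x)) (∨-identityʳ (A x)))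
  ... | tri≈ _ refl _ = trans Aa₃ (sym (trans (cong (_∨ Q₂ x) (S-below ≤-refl)) Q₂-a₃))
    where
    Q₂-a₃ : Q₂ x ≡ true
    Q₂-a₃ = trans (cong (λ v → (x ≡ᵇ a₂) ∨ ((x ≡ᵇ 1) ∨ v)) (≡ᵇ-refl x)) (trans (cong ((x ≡ᵇ a₂) ∨_) (∨-zeroʳ _)) (∨-zeroʳ _))
  ... | tri> _ _ x<a₃ = trans (A-below x x<a₃) (sym (cong (_∨ Q₂ x) (S-below (<⇒≤ x<a₃))))

  B-split : ∀ x → (A x ∧ not (x ≡ᵇ a₂)) ≡ S x ∨ Q₁ x
  B-split x with x ≟ a₂
  ... | yes refl = begin
    A x ∧ not (x ≡ᵇ x)   ≡⟨ cong (λ v → A x ∧ not v) (≡ᵇ-refl x) ⟩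
    A x ∧ false          ≡⟨ ∧-zeroʳ (A x) ⟩
    false                ≡⟨ cong₂ _∨_ (S-below (<⇒≤ a₂<a₃)) (cong₂ _∨_ (≡ᵇ-false (>⇒≢ 1<a₂)) (≡ᵇ-false (<⇒≢ a₂<a₃))) ⟨
    S x ∨ Q₁ x           ∎
    where open ≡-Reasoning
  ... | no x≢a₂ = begin
    A x ∧ not (x ≡ᵇ a₂)           ≡⟨ trans (cong (λ v → A x ∧ not v) (≡ᵇ-false x≢a₂)) (∧-identityʳ (A x)) ⟩
    A x                           ≡⟨ A-split x ⟩
    S x ∨ ((x ≡ᵇ a₂) ∨ Q₁ x)      ≡⟨ cong (λ v → S x ∨ (v ∨ Q₁ x)) (≡ᵇ-false x≢a₂) ⟩
    S x ∨ Q₁ x                    ∎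
    where open ≡-Reasoning

  S∩Q=∅ : ∀ {Q} → (∀ x → a₃ < x → Q x ≡ false) → Disjoint S Q
  S∩Q=∅ Q-above x S[x] = Q-above x (S-above S[x])

  pANo≡F : ∀ {n} → n ≤ M → pANo A a₂ n ≡ F n
  pANo≡F {n} n≤M = begin
    count (λ x → A x ∧ not (x ≡ᵇ a₂)) n n     ≡⟨ count-stable _ n n≤M ⟨
    count (λ x → A x ∧ not (x ≡ᵇ a₂)) M n     ≡⟨ count-cong B-split M n ⟩
    count (S ∪ Q₁) M n                        ≡⟨ count-∪ (S∩Q=∅ Q₁-above-b) M n ⟩
    F n                                       ∎
    where open ≡-Reasoning

  pA≡P : ∀ {n} → n ≤ M → pA A n ≡ P n
  pA≡P {n} n≤M = begin
    count A n n               ≡⟨ count-stable A n n≤M ⟨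
    count A M n               ≡⟨ count-cong A-split M n ⟩
    count (S ∪ Q₂) M n        ≡⟨ count-∪ (S∩Q=∅ Q₂-above-b) M n ⟩
    P n                       ∎
    where open ≡-Reasoning

proposition5p1 : (A : ℕ → Bool) (a₂ a₃ : ℕ)
    → A 0 ≡ false
    → A 1 ≡ true
    → 1 < a₂ → a₂ < a₃
    → A a₂ ≡ true → A a₃ ≡ true
    → (∀ x → 1 < x → x < a₂ → A x ≡ false)
    → (∀ x → a₂ < x → x < a₃ → A x ≡ false)
    → (∀ x y → A x ≡ true → A y ≡ true → a₃ < y → y < x → a₃ + y ≤ x)
    → (w z : ℕ) → a₃ + 1 ≤ w → 3 * a₂ ≤ z
    → pANo A a₂ (w + z) ≤ pANo A a₂ w * pA A z
proposition5p1 A a₂ a₃ A0 A1 1<a₂ a₂<a₃ Aa₂ Aa₃ gap₁ gap₂ sparse w z a₃+1≤w 3a₂≤z = begin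
  pANo A a₂ (w + z)           ≡⟨ pANo≡F ≤-refl ⟩
  F (w + z)                   ≤⟨ F-submult a₃≤w 3a₂≤z ≤-refl ⟩
  F w * P z                   ≡⟨ cong₂ _*_ (pANo≡F (m≤m+n w z)) (pA≡P (m≤n+m z w)) ⟨
  pANo A a₂ w * pA A z        ∎
  where
  open ≤-Reasoning
  a₃≤w : a₃ ≤ w
  a₃≤w = ≤-trans (m≤m+n a₃ 1) a₃+1≤w
  open SplitA A a₂ a₃ (w + z) A0 A1 1<a₂ a₂<a₃ Aa₂ Aa₃ gap₁ gap₂ sparse (≤-trans a₃≤w (m≤m+n w z))
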